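{- Let $p>5$ be a prime, and let $\{u_n\}_{n\geq0}$ be defined by $u_0=0$, $u_1=1$, $u_{n+1}=2u_n-5u_{n-1}$ for $n\geq1$. If $p\equiv1\pmod4$, then $$\frac{u_{p-1}}{p}\equiv\frac18\sum_{k=1}^{\frac{p-1}{4}}\frac{16^k}{k}+\frac38q_p(3)+\frac18q_p(5)\equiv-\frac12\sum_{k=1}^{\frac{p-1}{4}}\frac{16^k}{4k-1}+\frac34q_p(3)-\frac12q_p(5)\pmod p;$$ if $p\equiv3\pmod4$, then $$\frac{u_{p+1}}{p}\equiv-\frac58\sum_{k=1}^{\frac{p-3}{4}}\frac{16^k}{k}-\frac{15}8q_p(3)-\frac58q_p(5)\equiv\frac58\sum_{k=1}^{\frac{p+1}{4}}\frac{16^k}{4k-3}-\frac{15}4q_p(3)+\frac52q_p(5)\pmod p.$$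
   Context: $q_p(x)=\frac{x^{p-1}-1}{p}$ for $p\nmid x$. Congruences between rationals with denominators prime to $p$ are understood in the ring of $p$-integral rationals. -}

module Defs where

open import Data.Nat as ℕ using (ℕ; zero; suc)
open import Data.Integer as ℤ using (ℤ; +_)
open import Data.Integer.Divisibility as ℤD using ()
open import Data.Rational as ℚ using (ℚ; 0ℚ)

u : ℕ → ℤ
u zero = + 0
u (suc zero) = + 1
u (suc (suc n)) = (+ 2) ℤ.* u (suc n) ℤ.- (+ 5) ℤ.* u n

-- rational n / d; (only used with d ≠ 0; returns 0 for d = 0)
frac : ℤ → ℕ → ℚ
frac n zero = 0ℚ
frac n (suc d) = n ℚ./ suc d

q : ℕ → ℕ → ℚ
q p x = frac (+ (x ℕ.^ (p ℕ.∸ 1)) ℤ.- + 1) p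

Σ1 : ℕ → (ℕ → ℚ) → ℚ
Σ1 zero f = 0ℚ
Σ1 (suc m) f = Σ1 m f ℚ.+ f (suc m)

-- a ≡ b (mod p) in the ring of p-integral rationals: p divides the
-- numerator of the reduced fraction a - b (then its denominator is prime to p)
_≡_[modℚ_] : ℚ → ℚ → ℕ → Set
a ≡ b [modℚ p ] = (+ p) ℤD.∣ ℚ.numerator (a ℚ.- b)

-- Write T_r(n) = Σ_{j ≡ r (mod 4)} C(n,j) 2^j. Then (1 + 2i)^n = X_n + i Y_n with
-- X = T₀ - T₂ and Y = T₁ - T₃; as 1 ± 2i are the roots of x² - 2x + 5, Y_n = 2 u_n, and
-- X_n² + Y_n² = 5^n, Σ_r T_r(n) = 3^n, T₀ - T₁ + T₂ - T₃ = (-1)^n.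
-- For 0 < j < p, C(p,j)/p ≡ (-1)^(j-1)/j (mod p). Hence T_r(p)/p is p-integral for each class
-- r not containing p, and congruent to a fixed multiple of the matching sum Σ 16^k/(4k - s).
-- So X_p = 1 + p a and Y_p = ±2 + p b with a, b p-integral, and u_(p∓1)/p, q_p(5) and both sums
-- are congruent mod p to linear forms in q_p(3), a and b; each claimed congruence is an
-- identity between these forms.

module Submission where

open import Defs
open import Data.Nat as ℕ using (ℕ)
open import Data.Nat.Primality using (Prime)
open import Relation.Binary.PropositionalEquality using (_≡_)

module Embedding where

  open import Data.Integer.Base as ℤ using (ℤ; +_)
  open import Data.Integer.Tactic.RingSolver using (solve-∀)
  open import Data.Nat.Base as ℕ using (ℕ; suc; NonZero)
  open import Data.Rational.Base as ℚ using (ℚ; _+_; _*_; -_; _-_; toℚᵘ)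
  open import Data.Rational.Properties
    using (toℚᵘ-injective; toℚᵘ-fromℚᵘ; toℚᵘ-homo-+; toℚᵘ-homo-*; toℚᵘ-homo‿-; toℚᵘ-cong; ↥p/↧p≡p)
  open import Data.Rational.Unnormalised.Base as ℚᵘ using (mkℚᵘ; _≃_; *≡*)
  open import Data.Rational.Unnormalised.Properties as ℚᵘ using (≃-trans; ≃-sym)
  import Data.Integer.Properties as ℤ
  open import Relation.Binary.PropositionalEquality
  import Relation.Binary.Reasoning.Setoid as SetoidReasoning
  open SetoidReasoning ℚᵘ.≃-setoid

  fromℤ : ℤ → ℚ
  fromℤ n = frac n 1

  fromℕ : ℕ → ℚ
  fromℕ n = fromℤ (+ n)

  toℚᵘ-frac : ∀ n d → toℚᵘ (frac n (suc d)) ≃ mkℚᵘ n d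
  toℚᵘ-frac n d = toℚᵘ-fromℚᵘ (mkℚᵘ n d)

  fromℤ-+ : ∀ a b → fromℤ (a ℤ.+ b) ≡ fromℤ a + fromℤ b
  fromℤ-+ a b = toℚᵘ-injective (begin
    toℚᵘ (fromℤ (a ℤ.+ b))                 ≈⟨ toℚᵘ-frac (a ℤ.+ b) 0 ⟩
    mkℚᵘ (a ℤ.+ b) 0                      ≈⟨ *≡* (identity a b) ⟩
    mkℚᵘ a 0 ℚᵘ.+ mkℚᵘ b 0                ≈⟨ ℚᵘ.+-cong (toℚᵘ-frac a 0) (toℚᵘ-frac b 0) ⟨
    toℚᵘ (fromℤ a) ℚᵘ.+ toℚᵘ (fromℤ b)     ≈⟨ toℚᵘ-homo-+ (fromℤ a) (fromℤ b) ⟨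
    toℚᵘ (fromℤ a + fromℤ b)               ∎)
    where
    identity : ∀ a b → (a ℤ.+ b) ℤ.* + 1 ≡ (a ℤ.* + 1 ℤ.+ b ℤ.* + 1) ℤ.* + 1
    identity = solve-∀

  fromℤ-* : ∀ a b → fromℤ (a ℤ.* b) ≡ fromℤ a * fromℤ b
  fromℤ-* a b = toℚᵘ-injective (begin
    toℚᵘ (fromℤ (a ℤ.* b))                 ≈⟨ toℚᵘ-frac (a ℤ.* b) 0 ⟩
    mkℚᵘ (a ℤ.* b) 0                      ≈⟨ *≡* refl ⟩
    mkℚᵘ a 0 ℚᵘ.* mkℚᵘ b 0                ≈⟨ ℚᵘ.*-cong (toℚᵘ-frac a 0) (toℚᵘ-frac b 0) ⟨
    toℚᵘ (fromℤ a) ℚᵘ.* toℚᵘ (fromℤ b)     ≈⟨ toℚᵘ-homo-* (fromℤ a) (fromℤ b) ⟨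
    toℚᵘ (fromℤ a * fromℤ b)               ∎)

  fromℤ-neg : ∀ a → fromℤ (ℤ.- a) ≡ - fromℤ a
  fromℤ-neg a = toℚᵘ-injective (begin
    toℚᵘ (fromℤ (ℤ.- a))    ≈⟨ toℚᵘ-frac (ℤ.- a) 0 ⟩
    mkℚᵘ (ℤ.- a) 0          ≈⟨ ℚᵘ.-‿cong (toℚᵘ-frac a 0) ⟨
    ℚᵘ.- toℚᵘ (fromℤ a)     ≈⟨ toℚᵘ-homo‿- (fromℤ a) ⟨
    toℚᵘ (- fromℤ a)        ∎)

  frac-*-denominator : ∀ n d .{{_ : NonZero d}} → frac n d * fromℕ d ≡ fromℤ n
  frac-*-denominator n (suc d) = toℚᵘ-injective (begin
    toℚᵘ (frac n (suc d) * fromℕ (suc d))              ≈⟨ toℚᵘ-homo-* (frac n (suc d)) (fromℕ (suc d)) ⟩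
    toℚᵘ (frac n (suc d)) ℚᵘ.* toℚᵘ (fromℕ (suc d))    ≈⟨ ℚᵘ.*-cong (toℚᵘ-frac n d) (toℚᵘ-frac (+ suc d) 0) ⟩
    mkℚᵘ n d ℚᵘ.* mkℚᵘ (+ suc d) 0                    ≈⟨ *≡* (identity n (+ suc d)) ⟩
    mkℚᵘ n 0                                         ≈⟨ toℚᵘ-frac n 0 ⟨
    toℚᵘ (fromℤ n)                                   ∎)
    where
    identity : ∀ n s → (n ℤ.* s) ℤ.* + 1 ≡ n ℤ.* (s ℤ.* + 1)
    identity = solve-∀

  fromℤ-- : ∀ a b → fromℤ (a ℤ.- b) ≡ fromℤ a - fromℤ b
  fromℤ-- a b = trans (fromℤ-+ a (ℤ.- b)) (cong (_+_ (fromℤ a)) (fromℤ-neg b))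

  fromℕ-+ : ∀ m n → fromℕ (m ℕ.+ n) ≡ fromℕ m + fromℕ n
  fromℕ-+ m n = trans (cong fromℤ (ℤ.pos-+ m n)) (fromℤ-+ (+ m) (+ n))

  fromℕ-* : ∀ m n → fromℕ (m ℕ.* n) ≡ fromℕ m * fromℕ n
  fromℕ-* m n = trans (cong fromℤ (ℤ.pos-* m n)) (fromℤ-* (+ m) (+ n))

  *-denominator : ∀ x → x * fromℕ (ℚ.↧ₙ x) ≡ fromℤ (ℚ.↥ x)
  *-denominator x =
    trans (cong (_* fromℕ (ℚ.↧ₙ x)) (sym (↥p/↧p≡p x))) (frac-*-denominator (ℚ.↥ x) (ℚ.↧ₙ x))

  fromℤ-injective : ∀ {a b} → fromℤ a ≡ fromℤ b → a ≡ b
  fromℤ-injective {a} {b} eq with ≃-trans (≃-sym (toℚᵘ-frac a 0)) (≃-trans (toℚᵘ-cong eq) (toℚᵘ-frac b 0))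
  ... | *≡* a*1≡b*1 = trans (sym (ℤ.*-identityʳ a)) (trans a*1≡b*1 (ℤ.*-identityʳ b))

module Reciprocals where

  open import Data.Integer.Base using (+_)
  open import Data.Nat.Base as ℕ using (NonZero)
  open import Data.Rational.Base using (1ℚ; _*_)
  open import Data.Nat.Properties using (m*n≢0)
  open import Data.Rational.Properties using (*-assoc; *-comm; *-identityʳ)
  open import Data.Rational.Solver using (module +-*-Solver)
  open import Relation.Binary.PropositionalEquality
  open ≡-Reasoning
  open +-*-Solver using (solve; _:*_; _:=_)
  open Embedding

  *-cancelʳ-fromℕ : ∀ {x y} d .{{_ : NonZero d}} → x * fromℕ d ≡ y * fromℕ d → x ≡ y
  *-cancelʳ-fromℕ {x} {y} d eq = begin
    x                                  ≡⟨ cancel x ⟨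
    x * fromℕ d * frac (+ 1) d         ≡⟨ cong (_* frac (+ 1) d) eq ⟩
    y * fromℕ d * frac (+ 1) d         ≡⟨ cancel y ⟩
    y                                  ∎
    where
    cancel : ∀ z → z * fromℕ d * frac (+ 1) d ≡ z
    cancel z = begin
      z * fromℕ d * frac (+ 1) d       ≡⟨ *-assoc z (fromℕ d) (frac (+ 1) d) ⟩
      z * (fromℕ d * frac (+ 1) d)     ≡⟨ cong (z *_) (*-comm (fromℕ d) (frac (+ 1) d)) ⟩
      z * (frac (+ 1) d * fromℕ d)     ≡⟨ cong (z *_) (frac-*-denominator (+ 1) d) ⟩
      z * 1ℚ                           ≡⟨ *-identityʳ z ⟩
      z                                ∎

  frac-unique : ∀ {x} n d .{{_ : NonZero d}} → x * fromℕ d ≡ fromℤ n → x ≡ frac n d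
  frac-unique n d eq = *-cancelʳ-fromℕ d (trans eq (sym (frac-*-denominator n d)))

  frac≡fromℤ*frac1 : ∀ n d .{{_ : NonZero d}} → frac n d ≡ fromℤ n * frac (+ 1) d
  frac≡fromℤ*frac1 n d = sym (frac-unique n d (begin
    fromℤ n * frac (+ 1) d * fromℕ d    ≡⟨ *-assoc (fromℤ n) (frac (+ 1) d) (fromℕ d) ⟩
    fromℤ n * (frac (+ 1) d * fromℕ d)  ≡⟨ cong (fromℤ n *_) (frac-*-denominator (+ 1) d) ⟩
    fromℤ n * 1ℚ                        ≡⟨ *-identityʳ (fromℤ n) ⟩
    fromℤ n                             ∎))

  frac-*ˡ : ∀ n d k .{{_ : NonZero d}} .{{_ : NonZero k}} → frac n k ≡ fromℕ d * frac n (d ℕ.* k)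
  frac-*ˡ n d k = sym (frac-unique n k (begin
    fromℕ d * frac n (d ℕ.* k) * fromℕ k        ≡⟨ rearrange (fromℕ d) (frac n (d ℕ.* k)) (fromℕ k) ⟩
    frac n (d ℕ.* k) * (fromℕ d * fromℕ k)      ≡⟨ cong (frac n (d ℕ.* k) *_) (fromℕ-* d k) ⟨
    frac n (d ℕ.* k) * fromℕ (d ℕ.* k)          ≡⟨ frac-*-denominator n (d ℕ.* k) {{m*n≢0 d k}} ⟩
    fromℤ n                                    ∎))
    where
    rearrange : ∀ a b c → a * b * c ≡ b * (a * c)
    rearrange = solve 3 (λ a b c → a :* b :* c := b :* (a :* c)) refl

module Sums where

  open import Data.Nat.Base as ℕ using (zero; suc; _≤′_; ≤′-refl; ≤′-step)
  open import Data.Nat.Properties using (≤⇒≤′; ≤′⇒≤; m≤n⇒m≤1+n; ≤-refl)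
  open import Data.Rational.Base using (0ℚ; _+_; _*_)
  open import Data.Rational.Properties
    using (+-assoc; +-comm; +-identityʳ; *-distribˡ-+; *-zeroʳ; +-0-commutativeMonoid)
  open import Algebra.Bundles using (CommutativeMonoid)
  open import Algebra.Properties.CommutativeSemigroup
    (CommutativeMonoid.commutativeSemigroup +-0-commutativeMonoid) using (interchange)
  open import Relation.Binary.PropositionalEquality

  Σ1-+ : ∀ m f g → Σ1 m (λ k → f k + g k) ≡ Σ1 m f + Σ1 m g
  Σ1-+ zero f g = refl
  Σ1-+ (suc m) f g =
    trans (cong (_+ (f (suc m) + g (suc m))) (Σ1-+ m f g)) (interchange (Σ1 m f) (Σ1 m g) (f (suc m)) (g (suc m)))

  Σ1-* : ∀ m c f → Σ1 m (λ k → c * f k) ≡ c * Σ1 m f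
  Σ1-* zero c f = sym (*-zeroʳ c)
  Σ1-* (suc m) c f =
    trans (cong (_+ c * f (suc m)) (Σ1-* m c f)) (sym (*-distribˡ-+ c (Σ1 m f) (f (suc m))))

  Σ1-cong : ∀ m {f g} → (∀ {k} → 0 ℕ.< k → k ℕ.≤ m → f k ≡ g k) → Σ1 m f ≡ Σ1 m g
  Σ1-cong zero eq = refl
  Σ1-cong (suc m) eq = cong₂ _+_ (Σ1-cong m (λ 0<k k≤m → eq 0<k (m≤n⇒m≤1+n k≤m))) (eq (ℕ.s≤s ℕ.z≤n) ≤-refl)

  Σ1-suc : ∀ m f → Σ1 (suc m) f ≡ f 1 + Σ1 m (λ k → f (suc k))
  Σ1-suc zero f = +-comm 0ℚ (f 1)
  Σ1-suc (suc m) f =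
    trans (cong (_+ f (suc (suc m))) (Σ1-suc m f)) (+-assoc (f 1) _ _)

  Σ1-truncate : ∀ {m n} f → m ℕ.≤ n → (∀ {k} → m ℕ.< k → k ℕ.≤ n → f k ≡ 0ℚ) → Σ1 n f ≡ Σ1 m f
  Σ1-truncate f m≤n vanish = go (≤⇒≤′ m≤n) vanish
    where
    go : ∀ {m n} → m ≤′ n → (∀ {k} → m ℕ.< k → k ℕ.≤ n → f k ≡ 0ℚ) → Σ1 n f ≡ Σ1 m f
    go ≤′-refl _ = refl
    go {m} {suc n} (≤′-step m≤′n) vanish = begin
      Σ1 n f + f (suc n)      ≡⟨ cong (Σ1 n f +_) (vanish (ℕ.s≤s (≤′⇒≤ m≤′n)) ≤-refl) ⟩
      Σ1 n f + 0ℚ             ≡⟨ +-identityʳ (Σ1 n f) ⟩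
      Σ1 n f                  ≡⟨ go m≤′n (λ m<k k≤n → vanish m<k (m≤n⇒m≤1+n k≤n)) ⟩
      Σ1 m f                  ∎
      where open ≡-Reasoning

module Signs where

  open import Data.Nat.Base using (zero; suc; _+_)
  open import Data.Rational.Base using (ℚ; 1ℚ; _*_; -_)
  open import Data.Rational.Properties using (*-identityˡ; neg-distribˡ-*)
  open import Data.Rational.Solver using (module +-*-Solver)
  open import Relation.Binary.PropositionalEquality
  open +-*-Solver using (solve; _:*_; :-_; _:=_)

  sign : ℕ → ℚ
  sign zero = 1ℚ
  sign (suc n) = - sign n

  sign-+ : ∀ m n → sign (m + n) ≡ sign m * sign n
  sign-+ zero n = sym (*-identityˡ (sign n))
  sign-+ (suc m) n = trans (cong -_ (sign-+ m n)) (neg-distribˡ-* (sign m) (sign n))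

  sign-square : ∀ n → sign n * sign n ≡ 1ℚ
  sign-square zero = refl
  sign-square (suc n) = trans (identity (sign n)) (sign-square n)
    where
    identity : ∀ a → - a * - a ≡ a * a
    identity = solve 1 (λ a → :- a :* :- a := a :* a) refl

  sign-double : ∀ n → sign (n + n) ≡ 1ℚ
  sign-double n = trans (sign-+ n n) (sign-square n)

module Congruence (p : ℕ) (p-prime : Prime p) where

  open import Data.Integer.Base as ℤ using (ℤ; +_)
  import Data.Integer.Properties as ℤ
  open import Data.Nat.Base as ℕ using (NonZero; zero; suc)
  import Data.Nat.Properties as ℕ
  open import Data.Nat.Divisibility using (_∣_; divides; ∣⇒≤; ∣-refl; ∣m⇒∣m*n; ∣n⇒∣m*n)
  open import Data.Nat.Primality using (euclidsLemma; prime⇒nonZero; prime⇒nonTrivial)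
  open import Data.Sum using (inj₁; inj₂)
  open import Relation.Nullary using (¬_; contradiction)
  open import Data.Rational.Base as ℚ using (ℚ; 0ℚ; 1ℚ; _+_; _*_; -_; _-_)
  open import Data.Rational.Properties using (*-identityʳ; *-zeroˡ; *-comm; +-inverseʳ; neg-distribˡ-*)
  open import Data.Rational.Solver using (module +-*-Solver)
  open import Relation.Binary.Bundles using (Setoid)
  import Relation.Binary.Reasoning.Setoid as SetoidReasoning
  open import Relation.Binary.PropositionalEquality
  open ≡-Reasoning
  open +-*-Solver using (solve; _:+_; _:*_; _:-_; :-_; _:=_; con)
  open Embedding
  open Reciprocals
  open Signs

  instance
    p-nonZero : NonZero p
    p-nonZero = prime⇒nonZero p-prime

  p∤ : ∀ {d} .{{_ : NonZero d}} → d ℕ.< p → ¬ p ∣ d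
  p∤ d<p p∣d = ℕ.<⇒≱ d<p (∣⇒≤ p∣d)

  p∤1 : ¬ p ∣ 1
  p∤1 = p∤ (ℕ.nonTrivial⇒n>1 p {{prime⇒nonTrivial p-prime}})

  p∣ʳ-cancel : ∀ {m n} → p ∣ m ℕ.* n → ¬ p ∣ n → p ∣ m
  p∣ʳ-cancel {m} {n} p∣mn p∤n with euclidsLemma m n p-prime p∣mn
  ... | inj₁ p∣m = p∣m
  ... | inj₂ p∣n = contradiction p∣n p∤n

  p∤-* : ∀ {m n} → ¬ p ∣ m → ¬ p ∣ n → ¬ p ∣ m ℕ.* n
  p∤-* p∤m p∤n p∣mn = p∤m (p∣ʳ-cancel p∣mn p∤n)

  record Integral (x : ℚ) : Set where
    constructor integral
    field
      {denominator} : ℕ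
      p∤denominator : ¬ p ∣ denominator
      numerator : ℤ
      scaled : x * fromℕ denominator ≡ fromℤ numerator

  integral-frac : ∀ n d .{{_ : NonZero d}} → ¬ p ∣ d → Integral (frac n d)
  integral-frac n d p∤d = integral p∤d n (frac-*-denominator n d)

  integral-fromℤ : ∀ n → Integral (fromℤ n)
  integral-fromℤ n = integral p∤1 n (*-identityʳ (fromℤ n))

  integral-neg : ∀ {x} → Integral x → Integral (- x)
  integral-neg {x} (integral {d} p∤d n eq) = integral p∤d (ℤ.- n) (begin
    - x * fromℕ d     ≡⟨ neg-distribˡ-* x (fromℕ d) ⟨
    - (x * fromℕ d)   ≡⟨ cong -_ eq ⟩
    - fromℤ n         ≡⟨ fromℤ-neg n ⟨
    fromℤ (ℤ.- n)     ∎)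

  integral-+ : ∀ {x y} → Integral x → Integral y → Integral (x + y)
  integral-+ {x} {y} (integral {d₁} p∤d₁ n₁ eq₁) (integral {d₂} p∤d₂ n₂ eq₂) =
    integral (p∤-* p∤d₁ p∤d₂) (n₁ ℤ.* + d₂ ℤ.+ n₂ ℤ.* + d₁) (begin
      (x + y) * fromℕ (d₁ ℕ.* d₂)                            ≡⟨ cong ((x + y) *_) (fromℕ-* d₁ d₂) ⟩
      (x + y) * (fromℕ d₁ * fromℕ d₂)                         ≡⟨ identity x y (fromℕ d₁) (fromℕ d₂) ⟩
      x * fromℕ d₁ * fromℕ d₂ + y * fromℕ d₂ * fromℕ d₁       ≡⟨ cong₂ (λ a b → a * fromℕ d₂ + b * fromℕ d₁) eq₁ eq₂ ⟩
      fromℤ n₁ * fromℕ d₂ + fromℤ n₂ * fromℕ d₁               ≡⟨ cong₂ _+_ (fromℤ-* n₁ (+ d₂)) (fromℤ-* n₂ (+ d₁)) ⟨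
      fromℤ (n₁ ℤ.* + d₂) + fromℤ (n₂ ℤ.* + d₁)               ≡⟨ fromℤ-+ (n₁ ℤ.* + d₂) (n₂ ℤ.* + d₁) ⟨
      fromℤ (n₁ ℤ.* + d₂ ℤ.+ n₂ ℤ.* + d₁)                     ∎)
    where
    identity : ∀ x y a b → (x + y) * (a * b) ≡ x * a * b + y * b * a
    identity = solve 4 (λ x y a b → (x :+ y) :* (a :* b) := x :* a :* b :+ y :* b :* a) refl

  integral-* : ∀ {x y} → Integral x → Integral y → Integral (x * y)
  integral-* {x} {y} (integral {d₁} p∤d₁ n₁ eq₁) (integral {d₂} p∤d₂ n₂ eq₂) =
    integral (p∤-* p∤d₁ p∤d₂) (n₁ ℤ.* n₂) (begin
      x * y * fromℕ (d₁ ℕ.* d₂)                 ≡⟨ cong (x * y *_) (fromℕ-* d₁ d₂) ⟩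
      x * y * (fromℕ d₁ * fromℕ d₂)             ≡⟨ identity x y (fromℕ d₁) (fromℕ d₂) ⟩
      (x * fromℕ d₁) * (y * fromℕ d₂)           ≡⟨ cong₂ _*_ eq₁ eq₂ ⟩
      fromℤ n₁ * fromℤ n₂                       ≡⟨ fromℤ-* n₁ n₂ ⟨
      fromℤ (n₁ ℤ.* n₂)                         ∎)
    where
    identity : ∀ x y a b → x * y * (a * b) ≡ (x * a) * (y * b)
    identity = solve 4 (λ x y a b → x :* y :* (a :* b) := (x :* a) :* (y :* b)) refl

  1/p : ℚ
  1/p = frac (+ 1) p

  p*1/p : fromℕ p * 1/p ≡ 1ℚ
  p*1/p = trans (*-comm (fromℕ p) 1/p) (frac-*-denominator (+ 1) p)

  infix 4 _≈_

  record _≈_ (x y : ℚ) : Set where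
    constructor congruent
    field
      integral-quotient : Integral ((x - y) * 1/p)

  ≈-reflexive : ∀ {x y} → x ≡ y → x ≈ y
  ≈-reflexive {x} refl = congruent (subst Integral (begin
    fromℤ (+ 0)      ≡⟨ *-zeroˡ 1/p ⟨
    0ℚ * 1/p         ≡⟨ cong (_* 1/p) (+-inverseʳ x) ⟨
    (x - x) * 1/p    ∎) (integral-fromℤ (+ 0)))

  ≈-refl : ∀ {x} → x ≈ x
  ≈-refl = ≈-reflexive refl

  ≈-sym : ∀ {x y} → x ≈ y → y ≈ x
  ≈-sym {x} {y} (congruent ∫xy) = congruent (subst Integral (identity x y 1/p) (integral-neg ∫xy))
    where
    identity : ∀ x y i → - ((x - y) * i) ≡ (y - x) * i
    identity = solve 3 (λ x y i → :- ((x :- y) :* i) := (y :- x) :* i) refl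

  ≈-trans : ∀ {x y z} → x ≈ y → y ≈ z → x ≈ z
  ≈-trans {x} {y} {z} (congruent ∫xy) (congruent ∫yz) =
    congruent (subst Integral (identity x y z 1/p) (integral-+ ∫xy ∫yz))
    where
    identity : ∀ x y z i → (x - y) * i + (y - z) * i ≡ (x - z) * i
    identity = solve 4 (λ x y z i → (x :- y) :* i :+ (y :- z) :* i := (x :- z) :* i) refl

  ≈-setoid : Setoid _ _
  ≈-setoid = record
    { Carrier = ℚ
    ; _≈_ = _≈_
    ; isEquivalence = record { refl = ≈-refl ; sym = ≈-sym ; trans = ≈-trans }
    }

  module ≈-Reasoning = SetoidReasoning ≈-setoid

  +-cong : ∀ {x y u v} → x ≈ y → u ≈ v → x + u ≈ y + v
  +-cong {x} {y} {u} {v} (congruent ∫xy) (congruent ∫uv) =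
    congruent (subst Integral (identity x y u v 1/p) (integral-+ ∫xy ∫uv))
    where
    identity : ∀ x y u v i → (x - y) * i + (u - v) * i ≡ (x + u - (y + v)) * i
    identity = solve 5 (λ x y u v i → (x :- y) :* i :+ (u :- v) :* i := (x :+ u :- (y :+ v)) :* i) refl

  neg-cong : ∀ {x y} → x ≈ y → - x ≈ - y
  neg-cong {x} {y} (congruent ∫xy) = congruent (subst Integral (identity x y 1/p) (integral-neg ∫xy))
    where
    identity : ∀ x y i → - ((x - y) * i) ≡ (- x - - y) * i
    identity = solve 3 (λ x y i → :- ((x :- y) :* i) := (:- x :- :- y) :* i) refl

  -‿cong : ∀ {x y u v} → x ≈ y → u ≈ v → x - u ≈ y - v
  -‿cong x≈y u≈v = +-cong x≈y (neg-cong u≈v)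

  *-congˡ : ∀ {c x y} → Integral c → x ≈ y → c * x ≈ c * y
  *-congˡ {c} {x} {y} ∫c (congruent ∫xy) = congruent (subst Integral (identity c x y 1/p) (integral-* ∫c ∫xy))
    where
    identity : ∀ c x y i → c * ((x - y) * i) ≡ (c * x - c * y) * i
    identity = solve 4 (λ c x y i → c :* ((x :- y) :* i) := (c :* x :- c :* y) :* i) refl

  p*integral≈0 : ∀ {z} → Integral z → fromℕ p * z ≈ 0ℚ
  p*integral≈0 {z} ∫z = congruent (subst Integral (begin
    z                               ≡⟨ *-identityʳ z ⟨
    z * 1ℚ                          ≡⟨ cong (z *_) p*1/p ⟨
    z * (fromℕ p * 1/p)             ≡⟨ identity z (fromℕ p) 1/p ⟩
    (fromℕ p * z - 0ℚ) * 1/p        ∎) ∫z)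
    where
    identity : ∀ z q i → z * (q * i) ≡ (q * z - 0ℚ) * i
    identity = solve 3 (λ z q i → z :* (q :* i) := (q :* z :- con 0ℚ) :* i) refl

  ≈-sound : ∀ {x y} → x ≈ y → x ≡ y [modℚ p ]
  ≈-sound {x} {y} (congruent (integral {d} p∤d n eq)) = p∣ʳ-cancel p∣↥w*d p∤d
    where
    w = x - y
    E = fromℕ (ℚ.↧ₙ w)
    ↥w*d≡n*p*↧w : ℚ.↥ w ℤ.* + d ≡ n ℤ.* + p ℤ.* ℚ.↧ w
    ↥w*d≡n*p*↧w = fromℤ-injective (begin
      fromℤ (ℚ.↥ w ℤ.* + d)               ≡⟨ fromℤ-* (ℚ.↥ w) (+ d) ⟩
      fromℤ (ℚ.↥ w) * fromℕ d              ≡⟨ cong (_* fromℕ d) (*-denominator w) ⟨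
      w * E * fromℕ d                      ≡⟨ *-identityʳ (w * E * fromℕ d) ⟨
      w * E * fromℕ d * 1ℚ                 ≡⟨ cong (w * E * fromℕ d *_) p*1/p ⟨
      w * E * fromℕ d * (fromℕ p * 1/p)     ≡⟨ identity w E (fromℕ d) (fromℕ p) 1/p ⟩
      w * 1/p * fromℕ d * (fromℕ p * E)     ≡⟨ cong (_* (fromℕ p * E)) eq ⟩
      fromℤ n * (fromℕ p * E)              ≡⟨ cong (fromℤ n *_) (fromℤ-* (+ p) (ℚ.↧ w)) ⟨
      fromℤ n * fromℤ (+ p ℤ.* ℚ.↧ w)        ≡⟨ fromℤ-* n (+ p ℤ.* ℚ.↧ w) ⟨
      fromℤ (n ℤ.* (+ p ℤ.* ℚ.↧ w))          ≡⟨ cong fromℤ (ℤ.*-assoc n (+ p) (ℚ.↧ w)) ⟨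
      fromℤ (n ℤ.* + p ℤ.* ℚ.↧ w)            ∎)
      where
      identity : ∀ w e d q i → w * e * d * (q * i) ≡ w * i * d * (q * e)
      identity = solve 5 (λ w e d q i → w :* e :* d :* (q :* i) := w :* i :* d :* (q :* e)) refl
    p∣↥w*d : p ∣ ℤ.∣ ℚ.↥ w ∣ ℕ.* d
    p∣↥w*d = subst (p ∣_) (begin
      ℤ.∣ n ℤ.* + p ℤ.* ℚ.↧ w ∣              ≡⟨ cong ℤ.∣_∣ ↥w*d≡n*p*↧w ⟨
      ℤ.∣ ℚ.↥ w ℤ.* + d ∣                   ≡⟨ ℤ.abs-* (ℚ.↥ w) (+ d) ⟩
      ℤ.∣ ℚ.↥ w ∣ ℕ.* d                     ∎)
      (subst (p ∣_) (sym (ℤ.abs-* (n ℤ.* + p) (ℚ.↧ w)))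
        (∣m⇒∣m*n _ (subst (p ∣_) (sym (ℤ.abs-* n (+ p))) (∣n⇒∣m*n ℤ.∣ n ∣ ∣-refl))))

  Σ1-cong≈ : ∀ m {f g} → (∀ {k} → 0 ℕ.< k → k ℕ.≤ m → f k ≈ g k) → Σ1 m f ≈ Σ1 m g
  Σ1-cong≈ zero f≈g = ≈-refl
  Σ1-cong≈ (suc m) f≈g =
    +-cong (Σ1-cong≈ m (λ 0<k k≤m → f≈g 0<k (ℕ.m≤n⇒m≤1+n k≤m))) (f≈g (ℕ.s≤s ℕ.z≤n) ℕ.≤-refl)

  *-congʳ : ∀ {c x y} → Integral c → x ≈ y → x * c ≈ y * c
  *-congʳ {c} {x} {y} ∫c x≈y = subst₂ _≈_ (*-comm c x) (*-comm c y) (*-congˡ ∫c x≈y)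

  integral-sign : ∀ n → Integral (sign n)
  integral-sign zero = integral-fromℤ (+ 1)
  integral-sign (suc n) = integral-neg (integral-sign n)


  fromℕ-multiple≈0 : ∀ {n} → p ∣ n → fromℕ n ≈ 0ℚ
  fromℕ-multiple≈0 (divides q refl) = subst (_≈ 0ℚ) (sym (trans (fromℕ-* q p) (*-comm (fromℕ q) (fromℕ p))))
    (p*integral≈0 (integral-fromℤ (+ q)))

  integral-Σ1 : ∀ m {f} → (∀ {k} → 0 ℕ.< k → k ℕ.≤ m → Integral (f k)) → Integral (Σ1 m f)
  integral-Σ1 zero ∫f = integral-fromℤ (+ 0)
  integral-Σ1 (suc m) ∫f =
    integral-+ (integral-Σ1 m (λ 0<k k≤m → ∫f 0<k (ℕ.m≤n⇒m≤1+n k≤m))) (∫f (ℕ.s≤s ℕ.z≤n) ℕ.≤-refl)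

  ≈-integral : ∀ {x y} → x ≈ y → Integral y → Integral x
  ≈-integral {x} {y} (congruent ∫xy) ∫y =
    subst Integral (begin
      y + fromℕ p * ((x - y) * 1/p)     ≡⟨ identity x y (fromℕ p) 1/p ⟩
      x + (y - x) * (1ℚ - fromℕ p * 1/p) ≡⟨ cong (λ e → x + (y - x) * (1ℚ - e)) p*1/p ⟩
      x + (y - x) * (1ℚ - 1ℚ)            ≡⟨ identity′ x y ⟩
      x                                 ∎)
      (integral-+ ∫y (integral-* (integral-fromℤ (+ p)) ∫xy))
    where
    identity : ∀ x y q i → y + q * ((x - y) * i) ≡ x + (y - x) * (1ℚ - q * i)
    identity = solve 4 (λ x y q i → y :+ q :* ((x :- y) :* i) := x :+ (y :- x) :* (con 1ℚ :- q :* i)) refl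
    identity′ : ∀ x y → x + (y - x) * (1ℚ - 1ℚ) ≡ x
    identity′ = solve 2 (λ x y → x :+ (y :- x) :* (con 1ℚ :- con 1ℚ) := x) refl

module Binomial where

  open import Data.Nat.Base using (zero; suc; _+_; _*_; z≤n; s≤s)
  open import Data.Nat.Properties using (*-zeroʳ; *-identityʳ; +-identityʳ; *-distribˡ-+)
  open import Data.Nat.Combinatorics using (_C_; k>n⇒nCk≡0; nC1≡n; nCk+nC[k+1]≡[n+1]C[k+1])
  open import Data.Nat.Tactic.RingSolver using (solve-∀)
  open import Relation.Binary.PropositionalEquality
  open ≡-Reasoning

  absorption : ∀ n k → suc k * (suc n C suc k) ≡ suc n * (n C k)
  absorption zero zero = refl
  absorption zero (suc k) = begin
    (2 + k) * (1 C (2 + k))    ≡⟨ cong ((2 + k) *_) (k>n⇒nCk≡0 {1} {2 + k} (s≤s (s≤s z≤n))) ⟩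
    (2 + k) * 0                ≡⟨ *-zeroʳ (2 + k) ⟩
    0                          ≡⟨ k>n⇒nCk≡0 {0} {suc k} (s≤s z≤n) ⟨
    0 C suc k                  ≡⟨ +-identityʳ (0 C suc k) ⟨
    1 * (0 C suc k)            ∎
  absorption (suc n) zero = begin
    1 * ((2 + n) C 1)          ≡⟨ +-identityʳ ((2 + n) C 1) ⟩
    (2 + n) C 1                ≡⟨ nC1≡n (2 + n) ⟩
    2 + n                      ≡⟨ *-identityʳ (2 + n) ⟨
    (2 + n) * (suc n C 0)      ∎
  absorption (suc n) (suc k) = begin
    (2 + k) * ((2 + n) C (2 + k))                   ≡⟨ cong ((2 + k) *_) (nCk+nC[k+1]≡[n+1]C[k+1] (suc n) (suc k)) ⟨
    (2 + k) * (a + b)                              ≡⟨ split k a b ⟩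
    a + (suc k * a + (2 + k) * b)                   ≡⟨ cong₂ (λ x y → a + (x + y)) (absorption n k) (absorption n (suc k)) ⟩
    a + (suc n * (n C k) + suc n * (n C suc k))     ≡⟨ cong (a +_) (*-distribˡ-+ (suc n) (n C k) (n C suc k)) ⟨
    a + suc n * (n C k + n C suc k)                 ≡⟨ cong (λ x → a + suc n * x) (nCk+nC[k+1]≡[n+1]C[k+1] n k) ⟩
    (2 + n) * a                                     ∎
    where
    a = suc n C suc k
    b = suc n C (2 + k)
    split : ∀ k a b → (2 + k) * (a + b) ≡ a + (suc k * a + (2 + k) * b)
    split = solve-∀

module BinomialModP (p : ℕ) (p-prime : Prime p) where

  open import Data.Integer.Base using (+_)
  open import Data.Nat.Base as ℕ using (zero; suc; pred; _<_; z≤n; s≤s)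
  import Data.Nat.Properties as ℕ
  open import Data.Nat.Combinatorics using (_C_; k>n⇒nCk≡0; nCk+nC[k+1]≡[n+1]C[k+1])
  open import Data.Nat.Divisibility using (_∣_; divides)
  open import Data.Rational.Base using (0ℚ; 1ℚ; _+_; _*_; -_; _-_)
  open import Data.Rational.Properties using (*-identityˡ)
  open import Data.Rational.Solver using (module +-*-Solver)
  open import Relation.Binary.Definitions using (tri<; tri≈; tri>)
  open import Relation.Nullary using (contradiction)
  open import Relation.Binary.PropositionalEquality
  open +-*-Solver using (solve; _:+_; _:*_; _:-_; :-_; _:=_; con)
  open Embedding
  open Reciprocals
  open Signs
  open Congruence p p-prime
  open Binomial

  absorption-at-p : ∀ i → suc i ℕ.* (p C suc i) ≡ p ℕ.* (pred p C i)
  absorption-at-p i = subst (λ n → suc i ℕ.* (n C suc i) ≡ n ℕ.* (pred p C i)) (ℕ.suc-pred p) (absorption (pred p) i)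

  p∣pCj : ∀ {j} → 0 < j → j < p → p ∣ p C j
  p∣pCj {suc i} _ i<p = p∣ʳ-cancel (subst (p ∣_) (ℕ.*-comm (suc i) (p C suc i)) p∣[1+i]*pC[1+i]) (p∤ i<p)
    where
    p∣[1+i]*pC[1+i] : p ∣ suc i ℕ.* (p C suc i)
    p∣[1+i]*pC[1+i] = subst (p ∣_) (sym (absorption-at-p i)) (divides (pred p C i) (ℕ.*-comm p (pred p C i)))

  pCj≈0 : ∀ {j} → 0 < j → j ≢ p → fromℕ (p C j) ≈ 0ℚ
  pCj≈0 {j} 0<j j≢p with ℕ.<-cmp j p
  ... | tri< j<p _ _ = fromℕ-multiple≈0 (p∣pCj 0<j j<p)
  ... | tri≈ _ j≡p _ = contradiction j≡p j≢p
  ... | tri> _ _ j>p = ≈-reflexive (cong fromℕ (k>n⇒nCk≡0 j>p))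

  [p-1]Cj≈sign : ∀ j → j < p → fromℕ (pred p C j) ≈ sign j
  [p-1]Cj≈sign zero _ = ≈-refl
  [p-1]Cj≈sign (suc i) i+1<p = begin
    fromℕ (pred p C suc i)                              ≡⟨ pascal ⟩
    fromℕ (p C suc i) - fromℕ (pred p C i)              ≈⟨ -‿cong (pCj≈0 (s≤s z≤n) (ℕ.<⇒≢ i+1<p)) ([p-1]Cj≈sign i (ℕ.<-trans (ℕ.n<1+n i) i+1<p)) ⟩
    0ℚ - sign i                                         ≡⟨ identity (sign i) ⟩
    sign (suc i)                                        ∎
    where
    open ≈-Reasoning
    identity : ∀ a → 0ℚ - a ≡ - a
    identity = solve 1 (λ a → con 0ℚ :- a := :- a) refl
    a = pred p C i
    b = pred p C suc i
    pascal : fromℕ b ≡ fromℕ (p C suc i) - fromℕ a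
    pascal = trans (add-sub (fromℕ a) (fromℕ b)) (cong (_- fromℕ a) (trans (sym (fromℕ-+ a b))
      (cong fromℕ (trans (nCk+nC[k+1]≡[n+1]C[k+1] (pred p) i) (cong (_C suc i) (ℕ.suc-pred p))))))
      where
      add-sub : ∀ x y → y ≡ x + y - x
      add-sub = solve 2 (λ x y → y := x :+ y :- x) refl

  pC[1+i]/p≡ : ∀ i → 1/p * fromℕ (p C suc i) ≡ fromℕ (pred p C i) * frac (+ 1) (suc i)
  pC[1+i]/p≡ i = trans (frac-unique (+ c) (suc i) scaled) (frac≡fromℤ*frac1 (+ c) (suc i))
    where
    open ≡-Reasoning
    c = pred p C i
    rearrange : ∀ a b c → a * b * c ≡ a * (c * b)
    rearrange = solve 3 (λ a b c → a :* b :* c := a :* (c :* b)) refl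
    rearrange′ : ∀ a b c → a * (b * c) ≡ b * a * c
    rearrange′ = solve 3 (λ a b c → a :* (b :* c) := b :* a :* c) refl
    scaled : 1/p * fromℕ (p C suc i) * fromℕ (suc i) ≡ fromℕ c
    scaled = begin
      1/p * fromℕ (p C suc i) * fromℕ (suc i)       ≡⟨ rearrange 1/p (fromℕ (p C suc i)) (fromℕ (suc i)) ⟩
      1/p * (fromℕ (suc i) * fromℕ (p C suc i))     ≡⟨ cong (1/p *_) (fromℕ-* (suc i) (p C suc i)) ⟨
      1/p * fromℕ (suc i ℕ.* (p C suc i))           ≡⟨ cong (λ n → 1/p * fromℕ n) (absorption-at-p i) ⟩
      1/p * fromℕ (p ℕ.* c)                         ≡⟨ cong (1/p *_) (fromℕ-* p c) ⟩
      1/p * (fromℕ p * fromℕ c)                     ≡⟨ rearrange′ 1/p (fromℕ p) (fromℕ c) ⟩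
      fromℕ p * 1/p * fromℕ c                       ≡⟨ cong (_* fromℕ c) p*1/p ⟩
      1ℚ * fromℕ c                                  ≡⟨ *-identityˡ (fromℕ c) ⟩
      fromℕ c                                       ∎

  pC[1+i]/p≈ : ∀ i → suc i < p → 1/p * fromℕ (p C suc i) ≈ sign i * frac (+ 1) (suc i)
  pC[1+i]/p≈ i i+1<p = begin
    1/p * fromℕ (p C suc i)                   ≡⟨ pC[1+i]/p≡ i ⟩
    fromℕ (pred p C i) * frac (+ 1) (suc i)   ≈⟨ *-congʳ (integral-frac (+ 1) (suc i) (p∤ i+1<p)) ([p-1]Cj≈sign i (ℕ.<-trans (ℕ.n<1+n i) i+1<p)) ⟩
    sign i * frac (+ 1) (suc i)               ∎
    where open ≈-Reasoning

module Quadrisection where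

  import Data.Integer.Base as ℤ
  open import Data.Nat.Base as ℕ using (zero; suc; _∸_; _^_; z≤n; s≤s)
  open import Data.Product using (_×_; _,_; proj₁)
  import Data.Nat.Properties as ℕ
  open import Data.Nat.Combinatorics using (_C_; k>n⇒nCk≡0; nCk+nC[k+1]≡[n+1]C[k+1])
  open import Data.Rational.Base using (ℚ; 0ℚ; 1ℚ; _+_; _*_; -_; _-_)
  open import Data.Rational.Properties using (*-zeroˡ; *-identityˡ; +-identityˡ; +-identityʳ)
  open import Data.Nat.Tactic.RingSolver using (solve-∀)
  open import Data.Rational.Solver using (module +-*-Solver)
  open import Relation.Binary.PropositionalEquality
  open ≡-Reasoning
  open +-*-Solver using (solve; _:+_; _:*_; _:-_; :-_; _:=_; con)
  open Embedding
  open Sums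
  open Signs
  open Reciprocals

  -- Opaque: unfolding _C_ during unification is prohibitively slow.
  opaque
    term : ℕ → ℕ → ℚ
    term n j = fromℕ (n C j) * fromℕ (2 ^ j)

    term-pascal : ∀ n j → term (suc n) (suc j) ≡ term n (suc j) + fromℕ 2 * term n j
    term-pascal n j = begin
      fromℕ (suc n C suc j) * fromℕ (2 ^ suc j)                 ≡⟨ cong (λ c → fromℕ c * fromℕ (2 ^ suc j)) (nCk+nC[k+1]≡[n+1]C[k+1] n j) ⟨
      fromℕ (n C j ℕ.+ n C suc j) * fromℕ (2 ℕ.* 2 ^ j)         ≡⟨ cong₂ _*_ (fromℕ-+ (n C j) (n C suc j)) (fromℕ-* 2 (2 ^ j)) ⟩
      (fromℕ (n C j) + fromℕ (n C suc j)) * (fromℕ 2 * fromℕ (2 ^ j))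
        ≡⟨ identity (fromℕ (n C j)) (fromℕ (n C suc j)) (fromℕ 2) (fromℕ (2 ^ j)) ⟩
      fromℕ (n C suc j) * (fromℕ 2 * fromℕ (2 ^ j)) + fromℕ 2 * term n j
        ≡⟨ cong (λ w → fromℕ (n C suc j) * w + fromℕ 2 * term n j) (fromℕ-* 2 (2 ^ j)) ⟨
      term n (suc j) + fromℕ 2 * term n j                       ∎
      where
      identity : ∀ a b t w → (a + b) * (t * w) ≡ b * (t * w) + t * (a * w)
      identity = solve 4 (λ a b t w → (a :+ b) :* (t :* w) := b :* (t :* w) :+ t :* (a :* w)) refl

    term-vanish : ∀ {n j} → n ℕ.< j → term n j ≡ 0ℚ
    term-vanish {n} {j} n<j = trans (cong (λ c → fromℕ c * fromℕ (2 ^ j)) (k>n⇒nCk≡0 n<j)) (*-zeroˡ (fromℕ (2 ^ j)))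

    term-zero : ∀ n → term n 0 ≡ 1ℚ
    term-zero n = refl

    term-definition : ∀ n j → term n j ≡ fromℕ (n C j) * fromℕ (2 ^ j)
    term-definition n j = refl

  -- T s n sums C(n,j) 2^j over the j ≥ 1 with j ≡ -s (mod 4); X n + i Y n = (1 + 2i)^n.
  T : ℕ → ℕ → ℚ
  T s n = Σ1 (suc n) (λ k → term n (4 ℕ.* k ∸ s))

  4[1+k]∸4≡4k : ∀ k → 4 ℕ.* suc k ∸ 4 ≡ 4 ℕ.* k
  4[1+k]∸4≡4k k = trans (cong (_∸ 4) (ℕ.*-suc 4 k)) (ℕ.m+n∸m≡n 4 (4 ℕ.* k))

  4k≤4[1+k]∸s : ∀ k {s} → s ℕ.≤ 4 → 4 ℕ.* k ℕ.≤ 4 ℕ.* suc k ∸ s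
  4k≤4[1+k]∸s k {s} s≤4 = subst (ℕ._≤ 4 ℕ.* suc k ∸ s) (4[1+k]∸4≡4k k) (ℕ.∸-monoʳ-≤ (4 ℕ.* suc k) s≤4)

  4k∸s≡1+4k∸[1+s] : ∀ {k s} → 0 ℕ.< k → s ℕ.< 4 → 4 ℕ.* k ∸ s ≡ suc (4 ℕ.* k ∸ suc s)
  4k∸s≡1+4k∸[1+s] {k} {s} 0<k s<4 = ℕ.+-∸-assoc 1 (ℕ.<-≤-trans s<4 (ℕ.*-monoʳ-≤ 4 0<k))

  T-extend : ∀ s n → s ℕ.≤ 4 → Σ1 (suc (suc n)) (λ k → term n (4 ℕ.* k ∸ s)) ≡ T s n
  T-extend s n s≤4 = trans (cong (T s n +_) (term-vanish n<index)) (+-identityʳ (T s n))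
    where
    n<index : n ℕ.< 4 ℕ.* suc (suc n) ∸ s
    n<index = ℕ.<-≤-trans (ℕ.n<1+n n) (ℕ.≤-trans (ℕ.m≤n*m (suc n) 4) (4k≤4[1+k]∸s (suc n) s≤4))

  T-suc : ∀ s n → s ℕ.< 4 → T s (suc n) ≡ T s n + fromℕ 2 * T (suc s) n
  T-suc s n s<4 = begin
    Σ1 (2 ℕ.+ n) (λ k → term (suc n) (4 ℕ.* k ∸ s))
      ≡⟨ Σ1-cong (2 ℕ.+ n) pascal ⟩
    Σ1 (2 ℕ.+ n) (λ k → term n (4 ℕ.* k ∸ s) + fromℕ 2 * term n (4 ℕ.* k ∸ suc s))
      ≡⟨ Σ1-+ (2 ℕ.+ n) _ _ ⟩
    Σ1 (2 ℕ.+ n) (λ k → term n (4 ℕ.* k ∸ s)) + Σ1 (2 ℕ.+ n) (λ k → fromℕ 2 * term n (4 ℕ.* k ∸ suc s))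
      ≡⟨ cong₂ _+_ (T-extend s n (ℕ.<⇒≤ s<4))
                   (trans (Σ1-* (2 ℕ.+ n) (fromℕ 2) _) (cong (fromℕ 2 *_) (T-extend (suc s) n s<4))) ⟩
    T s n + fromℕ 2 * T (suc s) n
      ∎
    where
    pascal : ∀ {k} → 0 ℕ.< k → k ℕ.≤ 2 ℕ.+ n →
             term (suc n) (4 ℕ.* k ∸ s) ≡ term n (4 ℕ.* k ∸ s) + fromℕ 2 * term n (4 ℕ.* k ∸ suc s)
    pascal 0<k _ rewrite 4k∸s≡1+4k∸[1+s] 0<k s<4 = term-pascal n _

  T-4 : ∀ n → T 4 n ≡ 1ℚ + T 0 n
  T-4 n = begin
    T 4 n                                              ≡⟨ Σ1-suc n (λ k → term n (4 ℕ.* k ∸ 4)) ⟩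
    term n 0 + Σ1 n (λ k → term n (4 ℕ.* suc k ∸ 4))   ≡⟨ cong₂ _+_ (term-zero n) (Σ1-cong n (λ {k} _ _ → cong (term n) (4[1+k]∸4≡4k k))) ⟩
    1ℚ + Σ1 n (λ k → term n (4 ℕ.* k))                 ≡⟨ cong (1ℚ +_) drop-last ⟨
    1ℚ + T 0 n                                         ∎
    where
    drop-last : T 0 n ≡ Σ1 n (λ k → term n (4 ℕ.* k))
    drop-last = trans (cong (Σ1 n (λ k → term n (4 ℕ.* k)) +_) (term-vanish (ℕ.<-≤-trans (ℕ.n<1+n n) (ℕ.m≤n*m (suc n) 4))))
                      (+-identityʳ _)

  T-zero : ∀ s → s ℕ.< 4 → T s 0 ≡ 0ℚ
  T-zero s s<4 = trans (+-identityˡ (term 0 (4 ∸ s))) (term-vanish (ℕ.m<n⇒0<n∸m s<4))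

  X Y : ℕ → ℚ
  X n = 1ℚ + T 0 n - T 2 n
  Y n = T 3 n - T 1 n

  T-step : ∀ n (f : ℚ → ℚ → ℚ → ℚ → ℚ) →
           f (T 0 (suc n)) (T 1 (suc n)) (T 2 (suc n)) (T 3 (suc n)) ≡
           f (T 0 n + fromℕ 2 * T 1 n) (T 1 n + fromℕ 2 * T 2 n) (T 2 n + fromℕ 2 * T 3 n) (T 3 n + fromℕ 2 * (1ℚ + T 0 n))
  T-step n f = cong₄ f (T-suc 0 n (s≤s z≤n)) (T-suc 1 n (s≤s (s≤s z≤n))) (T-suc 2 n (s≤s (s≤s (s≤s z≤n))))
    (trans (T-suc 3 n ℕ.≤-refl) (cong (λ t → T 3 n + fromℕ 2 * t) (T-4 n)))
    where
    cong₄ : ∀ (f : ℚ → ℚ → ℚ → ℚ → ℚ) {a a′ b b′ c c′ d d′} →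
            a ≡ a′ → b ≡ b′ → c ≡ c′ → d ≡ d′ → f a b c d ≡ f a′ b′ c′ d′
    cong₄ f refl refl refl refl = refl

  T-total : ∀ n → 1ℚ + T 0 n + T 1 n + T 2 n + T 3 n ≡ fromℕ (3 ^ n)
  T-total zero
    rewrite T-zero 0 (s≤s z≤n) | T-zero 1 (s≤s (s≤s z≤n)) | T-zero 2 (s≤s (s≤s (s≤s z≤n))) | T-zero 3 ℕ.≤-refl = refl
  T-total (suc n) = begin
    1ℚ + T 0 (suc n) + T 1 (suc n) + T 2 (suc n) + T 3 (suc n)   ≡⟨ T-step n (λ a b c d → 1ℚ + a + b + c + d) ⟩
    _                                                         ≡⟨ identity (T 0 n) (T 1 n) (T 2 n) (T 3 n) ⟩
    fromℕ 3 * (1ℚ + T 0 n + T 1 n + T 2 n + T 3 n)              ≡⟨ cong (fromℕ 3 *_) (T-total n) ⟩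
    fromℕ 3 * fromℕ (3 ^ n)                                   ≡⟨ fromℕ-* 3 (3 ^ n) ⟨
    fromℕ (3 ^ suc n)                                         ∎
    where
    identity : ∀ a b c d → 1ℚ + (a + fromℕ 2 * b) + (b + fromℕ 2 * c) + (c + fromℕ 2 * d) + (d + fromℕ 2 * (1ℚ + a))
                           ≡ fromℕ 3 * (1ℚ + a + b + c + d)
    identity = solve 4 (λ a b c d → con 1ℚ :+ (a :+ con (fromℕ 2) :* b) :+ (b :+ con (fromℕ 2) :* c)
                                    :+ (c :+ con (fromℕ 2) :* d) :+ (d :+ con (fromℕ 2) :* (con 1ℚ :+ a))
                                    := con (fromℕ 3) :* (con 1ℚ :+ a :+ b :+ c :+ d)) refl

  T-alternating : ∀ n → 1ℚ + T 0 n - T 1 n + T 2 n - T 3 n ≡ sign n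
  T-alternating zero
    rewrite T-zero 0 (s≤s z≤n) | T-zero 1 (s≤s (s≤s z≤n)) | T-zero 2 (s≤s (s≤s (s≤s z≤n))) | T-zero 3 ℕ.≤-refl = refl
  T-alternating (suc n) = begin
    1ℚ + T 0 (suc n) - T 1 (suc n) + T 2 (suc n) - T 3 (suc n)   ≡⟨ T-step n (λ a b c d → 1ℚ + a - b + c - d) ⟩
    _                                                         ≡⟨ identity (T 0 n) (T 1 n) (T 2 n) (T 3 n) ⟩
    - (1ℚ + T 0 n - T 1 n + T 2 n - T 3 n)                     ≡⟨ cong -_ (T-alternating n) ⟩
    sign (suc n)                                              ∎
    where
    identity : ∀ a b c d → 1ℚ + (a + fromℕ 2 * b) - (b + fromℕ 2 * c) + (c + fromℕ 2 * d) - (d + fromℕ 2 * (1ℚ + a))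
                           ≡ - (1ℚ + a - b + c - d)
    identity = solve 4 (λ a b c d → con 1ℚ :+ (a :+ con (fromℕ 2) :* b) :- (b :+ con (fromℕ 2) :* c)
                                    :+ (c :+ con (fromℕ 2) :* d) :- (d :+ con (fromℕ 2) :* (con 1ℚ :+ a))
                                    := :- (con 1ℚ :+ a :- b :+ c :- d)) refl

  X-suc : ∀ n → X (suc n) ≡ X n - fromℕ 2 * Y n
  X-suc n = trans (T-step n (λ a b c d → 1ℚ + a - c)) (identity (T 0 n) (T 1 n) (T 2 n) (T 3 n))
    where
    identity : ∀ a b c d → 1ℚ + (a + fromℕ 2 * b) - (c + fromℕ 2 * d) ≡ 1ℚ + a - c - fromℕ 2 * (d - b)
    identity = solve 4 (λ a b c d → con 1ℚ :+ (a :+ con (fromℕ 2) :* b) :- (c :+ con (fromℕ 2) :* d)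
                                    := con 1ℚ :+ a :- c :- con (fromℕ 2) :* (d :- b)) refl

  Y-suc : ∀ n → Y (suc n) ≡ Y n + fromℕ 2 * X n
  Y-suc n = trans (T-step n (λ a b c d → d - b)) (identity (T 0 n) (T 1 n) (T 2 n) (T 3 n))
    where
    identity : ∀ a b c d → d + fromℕ 2 * (1ℚ + a) - (b + fromℕ 2 * c) ≡ d - b + fromℕ 2 * (1ℚ + a - c)
    identity = solve 4 (λ a b c d → d :+ con (fromℕ 2) :* (con 1ℚ :+ a) :- (b :+ con (fromℕ 2) :* c)
                                    := d :- b :+ con (fromℕ 2) :* (con 1ℚ :+ a :- c)) refl

  X-zero : X 0 ≡ 1ℚ
  X-zero rewrite T-zero 0 (s≤s z≤n) | T-zero 2 (s≤s (s≤s (s≤s z≤n))) = refl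

  Y-zero : Y 0 ≡ 0ℚ
  Y-zero rewrite T-zero 1 (s≤s (s≤s z≤n)) | T-zero 3 ℕ.≤-refl = refl

  norm : ∀ n → X n * X n + Y n * Y n ≡ fromℕ (5 ^ n)
  norm zero rewrite X-zero | Y-zero = refl
  norm (suc n) = begin
    X (suc n) * X (suc n) + Y (suc n) * Y (suc n)   ≡⟨ cong₂ (λ x y → x * x + y * y) (X-suc n) (Y-suc n) ⟩
    _                                             ≡⟨ identity (X n) (Y n) ⟩
    fromℕ 5 * (X n * X n + Y n * Y n)             ≡⟨ cong (fromℕ 5 *_) (norm n) ⟩
    fromℕ 5 * fromℕ (5 ^ n)                       ≡⟨ fromℕ-* 5 (5 ^ n) ⟨
    fromℕ (5 ^ suc n)                             ∎
    where
    identity : ∀ x y → (x - fromℕ 2 * y) * (x - fromℕ 2 * y) + (y + fromℕ 2 * x) * (y + fromℕ 2 * x)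
                       ≡ fromℕ 5 * (x * x + y * y)
    identity = solve 2 (λ x y → (x :- con (fromℕ 2) :* y) :* (x :- con (fromℕ 2) :* y)
                                :+ (y :+ con (fromℕ 2) :* x) :* (y :+ con (fromℕ 2) :* x)
                                := con (fromℕ 5) :* (x :* x :+ y :* y)) refl

  Y-suc-suc : ∀ n → Y (suc (suc n)) ≡ fromℕ 2 * Y (suc n) - fromℕ 5 * Y n
  Y-suc-suc n = begin
    Y (suc (suc n))                                          ≡⟨ Y-suc (suc n) ⟩
    Y (suc n) + fromℕ 2 * X (suc n)                          ≡⟨ cong₂ (λ y x → y + fromℕ 2 * x) (Y-suc n) (X-suc n) ⟩
    Y n + fromℕ 2 * X n + fromℕ 2 * (X n - fromℕ 2 * Y n)     ≡⟨ identity (X n) (Y n) ⟩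
    fromℕ 2 * (Y n + fromℕ 2 * X n) - fromℕ 5 * Y n           ≡⟨ cong (λ y → fromℕ 2 * y - fromℕ 5 * Y n) (Y-suc n) ⟨
    fromℕ 2 * Y (suc n) - fromℕ 5 * Y n                      ∎
    where
    identity : ∀ x y → y + fromℕ 2 * x + fromℕ 2 * (x - fromℕ 2 * y) ≡ fromℕ 2 * (y + fromℕ 2 * x) - fromℕ 5 * y
    identity = solve 2 (λ x y → y :+ con (fromℕ 2) :* x :+ con (fromℕ 2) :* (x :- con (fromℕ 2) :* y)
                                := con (fromℕ 2) :* (y :+ con (fromℕ 2) :* x) :- con (fromℕ 5) :* y) refl

  Y≡2u : ∀ n → Y n ≡ fromℕ 2 * fromℤ (u n)
  Y≡2u n = proj₁ (both n)
    where
    both : ∀ n → Y n ≡ fromℕ 2 * fromℤ (u n) × Y (suc n) ≡ fromℕ 2 * fromℤ (u (suc n))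
    both zero = Y-zero , trans (Y-suc 0) (cong₂ (λ y x → y + fromℕ 2 * x) Y-zero X-zero)
    both (suc n) with both n
    ... | Yₙ≡2uₙ , Yₙ₊₁≡2uₙ₊₁ = Yₙ₊₁≡2uₙ₊₁ , (begin
      Y (suc (suc n))                                                 ≡⟨ Y-suc-suc n ⟩
      fromℕ 2 * Y (suc n) - fromℕ 5 * Y n                              ≡⟨ cong₂ (λ a b → fromℕ 2 * a - fromℕ 5 * b) Yₙ₊₁≡2uₙ₊₁ Yₙ≡2uₙ ⟩
      fromℕ 2 * (fromℕ 2 * fromℤ (u (suc n))) - fromℕ 5 * (fromℕ 2 * fromℤ (u n))
        ≡⟨ identity (fromℕ 2) (fromℕ 5) (fromℤ (u (suc n))) (fromℤ (u n)) ⟩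
      fromℕ 2 * (fromℕ 2 * fromℤ (u (suc n)) - fromℕ 5 * fromℤ (u n))
        ≡⟨ cong (fromℕ 2 *_) (cong₂ _-_ (fromℤ-* (ℤ.+ 2) (u (suc n))) (fromℤ-* (ℤ.+ 5) (u n))) ⟨
      fromℕ 2 * (fromℤ (ℤ.+ 2 ℤ.* u (suc n)) - fromℤ (ℤ.+ 5 ℤ.* u n))       ≡⟨ cong (fromℕ 2 *_) (fromℤ-- (ℤ.+ 2 ℤ.* u (suc n)) (ℤ.+ 5 ℤ.* u n)) ⟨
      fromℕ 2 * fromℤ (u (suc (suc n)))                               ∎)
      where
      identity : ∀ t f a b → t * (t * a) - f * (t * b) ≡ t * (t * a - f * b)
      identity = solve 4 (λ t f a b → t :* (t :* a) :- f :* (t :* b) := t :* (t :* a :- f :* b)) refl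

  4T₀ : ∀ n → fromℕ 4 * T 0 n ≡ fromℕ (3 ^ n) + sign n + fromℕ 2 * X n - fromℕ 4
  4T₀ n = begin
    fromℕ 4 * T 0 n                                                              ≡⟨ identity (T 0 n) (T 1 n) (T 2 n) (T 3 n) ⟩
    (1ℚ + T 0 n + T 1 n + T 2 n + T 3 n) + (1ℚ + T 0 n - T 1 n + T 2 n - T 3 n) + fromℕ 2 * X n - fromℕ 4
      ≡⟨ cong₂ (λ t a → t + a + fromℕ 2 * X n - fromℕ 4) (T-total n) (T-alternating n) ⟩
    fromℕ (3 ^ n) + sign n + fromℕ 2 * X n - fromℕ 4                             ∎
    where
    identity : ∀ a b c d → fromℕ 4 * a ≡ (1ℚ + a + b + c + d) + (1ℚ + a - b + c - d) + fromℕ 2 * (1ℚ + a - c) - fromℕ 4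
    identity = solve 4 (λ a b c d → con (fromℕ 4) :* a
      := (con 1ℚ :+ a :+ b :+ c :+ d) :+ (con 1ℚ :+ a :- b :+ c :- d) :+ con (fromℕ 2) :* (con 1ℚ :+ a :- c) :- con (fromℕ 4)) refl

  4T₁ : ∀ n → fromℕ 4 * T 1 n ≡ fromℕ (3 ^ n) - sign n - fromℕ 2 * Y n
  4T₁ n = begin
    fromℕ 4 * T 1 n                                                              ≡⟨ identity (T 0 n) (T 1 n) (T 2 n) (T 3 n) ⟩
    (1ℚ + T 0 n + T 1 n + T 2 n + T 3 n) - (1ℚ + T 0 n - T 1 n + T 2 n - T 3 n) - fromℕ 2 * Y n
      ≡⟨ cong₂ (λ t a → t - a - fromℕ 2 * Y n) (T-total n) (T-alternating n) ⟩
    fromℕ (3 ^ n) - sign n - fromℕ 2 * Y n                                       ∎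
    where
    identity : ∀ a b c d → fromℕ 4 * b ≡ (1ℚ + a + b + c + d) - (1ℚ + a - b + c - d) - fromℕ 2 * (d - b)
    identity = solve 4 (λ a b c d → con (fromℕ 4) :* b
      := (con 1ℚ :+ a :+ b :+ c :+ d) :- (con 1ℚ :+ a :- b :+ c :- d) :- con (fromℕ 2) :* (d :- b)) refl

  4T₃ : ∀ n → fromℕ 4 * T 3 n ≡ fromℕ (3 ^ n) - sign n + fromℕ 2 * Y n
  4T₃ n = begin
    fromℕ 4 * T 3 n                                                              ≡⟨ identity (T 0 n) (T 1 n) (T 2 n) (T 3 n) ⟩
    (1ℚ + T 0 n + T 1 n + T 2 n + T 3 n) - (1ℚ + T 0 n - T 1 n + T 2 n - T 3 n) + fromℕ 2 * Y n
      ≡⟨ cong₂ (λ t a → t - a + fromℕ 2 * Y n) (T-total n) (T-alternating n) ⟩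
    fromℕ (3 ^ n) - sign n + fromℕ 2 * Y n                                       ∎
    where
    identity : ∀ a b c d → fromℕ 4 * d ≡ (1ℚ + a + b + c + d) - (1ℚ + a - b + c - d) + fromℕ 2 * (d - b)
    identity = solve 4 (λ a b c d → con (fromℕ 4) :* d
      := (con 1ℚ :+ a :+ b :+ c :+ d) :- (con 1ℚ :+ a :- b :+ c :- d) :+ con (fromℕ 2) :* (d :- b)) refl

  10u≡Y-2X : ∀ n → fromℕ 10 * fromℤ (u n) ≡ Y (suc n) - fromℕ 2 * X (suc n)
  10u≡Y-2X n = begin
    fromℕ 10 * fromℤ (u n)                          ≡⟨ identity (fromℤ (u n)) ⟩
    fromℕ 5 * (fromℕ 2 * fromℤ (u n))               ≡⟨ cong (fromℕ 5 *_) (Y≡2u n) ⟨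
    fromℕ 5 * Y n                                   ≡⟨ identity′ (X n) (Y n) ⟩
    Y n + fromℕ 2 * X n - fromℕ 2 * (X n - fromℕ 2 * Y n) ≡⟨ cong₂ (λ y x → y - fromℕ 2 * x) (Y-suc n) (X-suc n) ⟨
    Y (suc n) - fromℕ 2 * X (suc n)                 ∎
    where
    identity : ∀ v → fromℕ 10 * v ≡ fromℕ 5 * (fromℕ 2 * v)
    identity = solve 1 (λ v → con (fromℕ 10) :* v := con (fromℕ 5) :* (con (fromℕ 2) :* v)) refl
    identity′ : ∀ x y → fromℕ 5 * y ≡ y + fromℕ 2 * x - fromℕ 2 * (x - fromℕ 2 * y)
    identity′ = solve 2 (λ x y → con (fromℕ 5) :* y
      := y :+ con (fromℕ 2) :* x :- con (fromℕ 2) :* (x :- con (fromℕ 2) :* y)) refl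

  frac16^k≡ : ∀ {k s} → 0 ℕ.< k → s ℕ.≤ 3 →
              frac (ℤ.+ (16 ^ k)) (4 ℕ.* k ∸ s) ≡
              sign (suc s) * fromℕ (2 ^ s) * (sign (ℕ.pred (4 ℕ.* k ∸ s)) * frac (ℤ.+ 1) (4 ℕ.* k ∸ s) * fromℕ (2 ^ (4 ℕ.* k ∸ s)))
  frac16^k≡ {k} {s} 0<k s≤3 = begin
    frac (ℤ.+ (16 ^ k)) j                                                 ≡⟨ frac≡fromℤ*frac1 (ℤ.+ (16 ^ k)) j ⟩
    fromℕ (16 ^ k) * frac (ℤ.+ 1) j                                       ≡⟨ cong (_* frac (ℤ.+ 1) j) (*-identityˡ (fromℕ (16 ^ k))) ⟨
    1ℚ * fromℕ (16 ^ k) * frac (ℤ.+ 1) j                                  ≡⟨ cong₂ (λ σ e → σ * fromℕ e * frac (ℤ.+ 1) j) sign-exponent power ⟨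
    sign (suc s ℕ.+ ℕ.pred j) * fromℕ (2 ^ s ℕ.* 2 ^ j) * frac (ℤ.+ 1) j
      ≡⟨ cong₂ (λ σ e → σ * e * frac (ℤ.+ 1) j) (sign-+ (suc s) (ℕ.pred j)) (fromℕ-* (2 ^ s) (2 ^ j)) ⟩
    sign (suc s) * sign (ℕ.pred j) * (fromℕ (2 ^ s) * fromℕ (2 ^ j)) * frac (ℤ.+ 1) j
      ≡⟨ identity (sign (suc s)) (sign (ℕ.pred j)) (fromℕ (2 ^ s)) (fromℕ (2 ^ j)) (frac (ℤ.+ 1) j) ⟩
    sign (suc s) * fromℕ (2 ^ s) * (sign (ℕ.pred j) * frac (ℤ.+ 1) j * fromℕ (2 ^ j)) ∎
    where
    j = 4 ℕ.* k ∸ s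
    s<4k : s ℕ.< 4 ℕ.* k
    s<4k = ℕ.≤-trans (s≤s s≤3) (ℕ.*-monoʳ-≤ 4 0<k)
    instance
      j-nonZero : ℕ.NonZero j
      j-nonZero = ℕ.>-nonZero (ℕ.m<n⇒0<n∸m s<4k)
    s+j≡4k : s ℕ.+ j ≡ 4 ℕ.* k
    s+j≡4k = ℕ.m+[n∸m]≡n (ℕ.<⇒≤ s<4k)
    sign-exponent : sign (suc s ℕ.+ ℕ.pred j) ≡ 1ℚ
    sign-exponent = begin
      sign (suc s ℕ.+ ℕ.pred j)         ≡⟨ cong sign (trans (sym (ℕ.+-suc s (ℕ.pred j))) (cong (s ℕ.+_) (ℕ.suc-pred j))) ⟩
      sign (s ℕ.+ j)                    ≡⟨ cong sign (trans s+j≡4k (4k≡2k+2k k)) ⟩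
      sign (2 ℕ.* k ℕ.+ 2 ℕ.* k)        ≡⟨ sign-double (2 ℕ.* k) ⟩
      1ℚ                                ∎
      where
      4k≡2k+2k : ∀ k → 4 ℕ.* k ≡ 2 ℕ.* k ℕ.+ 2 ℕ.* k
      4k≡2k+2k = solve-∀
    power : 2 ^ s ℕ.* 2 ^ j ≡ 16 ^ k
    power = trans (sym (ℕ.^-distribˡ-+-* 2 s j)) (trans (cong (2 ^_) s+j≡4k) (sym (ℕ.^-*-assoc 2 4 k)))
    identity : ∀ σ τ a b c → σ * τ * (a * b) * c ≡ σ * a * (τ * c * b)
    identity = solve 5 (λ σ τ a b c → σ :* τ :* (a :* b) :* c := σ :* a :* (τ :* c :* b)) refl

module QuadrisectionModP (p : ℕ) (p-prime : Prime p) where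

  import Data.Integer.Base as ℤ
  open import Data.Nat.Base as ℕ using (suc; pred; _∸_; _^_; s≤s)
  import Data.Nat.Properties as ℕ
  open import Data.Nat.Combinatorics using (_C_)
  open import Data.Rational.Base using (_*_)
  open import Data.Rational.Properties using (*-assoc)
  open import Relation.Binary.PropositionalEquality
  open Embedding
  open Sums using (Σ1-*; Σ1-truncate)
  open Signs
  open Congruence p p-prime
  open BinomialModP p p-prime
  open Quadrisection

  term/p≈ : ∀ {j} → 0 ℕ.< j → j ℕ.< p → 1/p * term p j ≈ sign (pred j) * frac (ℤ.+ 1) j * fromℕ (2 ^ j)
  term/p≈ {suc i} _ i+1<p = begin
    1/p * term p (suc i)                                   ≡⟨ cong (1/p *_) (term-definition p (suc i)) ⟩
    1/p * (fromℕ (p C suc i) * fromℕ (2 ^ suc i))          ≡⟨ *-assoc 1/p _ _ ⟨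
    1/p * fromℕ (p C suc i) * fromℕ (2 ^ suc i)            ≈⟨ *-congʳ (integral-fromℤ (ℤ.+ (2 ^ suc i))) (pC[1+i]/p≈ i i+1<p) ⟩
    sign i * frac (ℤ.+ 1) (suc i) * fromℕ (2 ^ suc i)      ∎
    where open ≈-Reasoning

  module _ {s K : ℕ} (s≤3 : s ℕ.≤ 3) (K≤p : K ℕ.≤ p) (below : 4 ℕ.* K ℕ.< p ℕ.+ s) (above : p ℕ.+ s ℕ.< 4 ℕ.* suc K) where

    private
      j = λ k → 4 ℕ.* k ∸ s

      s<4k : ∀ {k} → 0 ℕ.< k → s ℕ.< 4 ℕ.* k
      s<4k 0<k = ℕ.≤-trans (s≤s s≤3) (ℕ.*-monoʳ-≤ 4 0<k)

      0<j : ∀ {k} → 0 ℕ.< k → 0 ℕ.< j k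
      0<j 0<k = ℕ.m<n⇒0<n∸m (s<4k 0<k)

      j<p : ∀ {k} → 0 ℕ.< k → k ℕ.≤ K → j k ℕ.< p
      j<p {k} 0<k k≤K = subst (j k ℕ.<_) (ℕ.m+n∸n≡m p s)
        (ℕ.∸-monoˡ-< (ℕ.≤-<-trans (ℕ.*-monoʳ-≤ 4 k≤K) below) (ℕ.<⇒≤ (s<4k 0<k)))

      p<j : ∀ {k} → K ℕ.< k → p ℕ.< j k
      p<j {k} K<k = subst (ℕ._< j k) (ℕ.m+n∸n≡m p s)
        (ℕ.∸-monoˡ-< (ℕ.<-≤-trans above (ℕ.*-monoʳ-≤ 4 K<k)) (ℕ.m≤n+m s p))

    T/p≡Σ : 1/p * T s p ≡ Σ1 K (λ k → 1/p * term p (j k))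
    T/p≡Σ = begin
      1/p * Σ1 (suc p) (λ k → term p (j k))     ≡⟨ cong (1/p *_) (Σ1-truncate _ (ℕ.m≤n⇒m≤1+n K≤p) (λ K<k _ → term-vanish (p<j K<k))) ⟩
      1/p * Σ1 K (λ k → term p (j k))           ≡⟨ Σ1-* K 1/p _ ⟨
      Σ1 K (λ k → 1/p * term p (j k))           ∎
      where open ≡-Reasoning

    T/p-integral : Integral (1/p * T s p)
    T/p-integral = subst Integral (sym T/p≡Σ) (integral-Σ1 K term/p-integral)
      where
      term/p-integral : ∀ {k} → 0 ℕ.< k → k ℕ.≤ K → Integral (1/p * term p (j k))
      term/p-integral {k} 0<k k≤K = ≈-integral (term/p≈ (0<j 0<k) (j<p 0<k k≤K))
        (integral-* (integral-* (integral-sign (pred (j k))) (integral-frac (ℤ.+ 1) (j k) (p∤ (j<p 0<k k≤K))))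
                    (integral-fromℤ (ℤ.+ (2 ^ j k))))
        where
        instance
          j-nonZero : ℕ.NonZero (j k)
          j-nonZero = ℕ.>-nonZero (0<j 0<k)

    Σ16^k≈ : Σ1 K (λ k → frac (ℤ.+ (16 ^ k)) (j k)) ≈ sign (suc s) * fromℕ (2 ^ s) * (1/p * T s p)
    Σ16^k≈ = begin
      Σ1 K (λ k → frac (ℤ.+ (16 ^ k)) (j k))
        ≡⟨ Sums.Σ1-cong K (λ 0<k _ → frac16^k≡ 0<k s≤3) ⟩
      Σ1 K (λ k → c * (sign (pred (j k)) * frac (ℤ.+ 1) (j k) * fromℕ (2 ^ j k)))
        ≈⟨ Σ1-cong≈ K (λ 0<k k≤K → *-congˡ ∫c (≈-sym (term/p≈ (0<j 0<k) (j<p 0<k k≤K)))) ⟩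
      Σ1 K (λ k → c * (1/p * term p (j k)))
        ≡⟨ Σ1-* K c _ ⟩
      c * Σ1 K (λ k → 1/p * term p (j k))
        ≡⟨ cong (c *_) T/p≡Σ ⟨
      c * (1/p * T s p)                       ∎
      where
      open ≈-Reasoning
      c = sign (suc s) * fromℕ (2 ^ s)
      ∫c : Integral c
      ∫c = integral-* (integral-sign (suc s)) (integral-fromℤ (ℤ.+ (2 ^ s)))

module OddPrime (p : ℕ) (p-prime : Prime p) (5<p : 5 ℕ.< p) (h : ℕ) (p≡1+2h : p ≡ ℕ.suc (h ℕ.+ h)) where

  open import Data.Integer.Base as ℤ using (+_)
  open import Data.Nat.Base as ℕ using (suc; _∸_; _^_; z≤n; s≤s)
  import Data.Nat.Properties as ℕ
  open import Data.Rational.Base using (ℚ; 0ℚ; 1ℚ; _+_; _*_; -_; _-_)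
  open import Data.Rational.Properties using (+-inverseˡ)
  open import Data.Rational.Solver using (module +-*-Solver)
  open import Data.Nat.Divisibility using (_∣_)
  open import Relation.Nullary using (¬_)
  open import Relation.Binary.PropositionalEquality
  open +-*-Solver using (solve; _:+_; _:*_; _:-_; :-_; _:=_; con)
  open Embedding
  open Reciprocals
  open Signs
  open Sums using (Σ1-*)
  open Congruence p p-prime
  open Quadrisection
  open QuadrisectionModP p p-prime

  sign-p : sign p ≡ - 1ℚ
  sign-p = trans (cong sign p≡1+2h) (cong -_ (sign-double h))

  p∤2 : ¬ p ∣ 2
  p∤2 = p∤ (ℕ.<-trans (s≤s (s≤s (s≤s z≤n))) 5<p)

  p∤4 : ¬ p ∣ 4
  p∤4 = p∤ (ℕ.<-trans (s≤s (s≤s (s≤s (s≤s (s≤s z≤n))))) 5<p)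

  p∤5 : ¬ p ∣ 5
  p∤5 = p∤ 5<p

  integral-/2 : ∀ n → Integral (frac n 2)
  integral-/2 n = integral-frac n 2 p∤2

  integral-/8 : ∀ n → Integral (frac n 8)
  integral-/8 n = integral-frac n 8 (p∤-* p∤2 p∤4)

  q≡ : ∀ c → q p c ≡ (fromℕ (c ^ (p ∸ 1)) - 1ℚ) * 1/p
  q≡ c = trans (frac≡fromℤ*frac1 (+ (c ^ (p ∸ 1)) ℤ.- + 1) p) (cong (_* 1/p) (fromℤ-- (+ (c ^ (p ∸ 1))) (+ 1)))

  fromℕ[c^p] : ∀ c → fromℕ (c ^ p) ≡ fromℕ c * fromℕ (c ^ (p ∸ 1))
  fromℕ[c^p] c = trans (cong (λ e → fromℕ (c ^ e)) (sym (ℕ.suc-pred p))) (fromℕ-* c (c ^ (p ∸ 1)))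

  t : ℕ → ℚ
  t s = 1/p * T s p

  a : ℚ
  a = (X p - 1ℚ) * 1/p

  b : ℚ → ℚ
  b c = (Y p - c) * 1/p

  t-integral⇒X≈1 : Integral (t 0) → Integral (t 2) → X p ≈ 1ℚ
  t-integral⇒X≈1 ∫t₀ ∫t₂ = congruent (subst Integral (identity 1/p (T 0 p) (T 2 p)) (integral-+ ∫t₀ (integral-neg ∫t₂)))
    where
    identity : ∀ i x z → i * x + - (i * z) ≡ (1ℚ + x - z - 1ℚ) * i
    identity = solve 3 (λ i x z → i :* x :+ :- (i :* z) := (con 1ℚ :+ x :- z :- con 1ℚ) :* i) refl

  alternating-p : 1ℚ + T 0 p - T 1 p + T 2 p - T 3 p + 1ℚ ≡ 0ℚ
  alternating-p = trans (cong (_+ 1ℚ) (trans (T-alternating p) sign-p)) (+-inverseˡ 1ℚ)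

  t-integral⇒Y≈2 : Integral (t 0) → Integral (t 1) → Integral (t 2) → Y p ≈ fromℕ 2
  t-integral⇒Y≈2 ∫t₀ ∫t₁ ∫t₂ = congruent (subst Integral (begin
    t 0 + t 2 - fromℕ 2 * t 1                                             ≡⟨ identity 1/p (T 0 p) (T 1 p) (T 2 p) (T 3 p) ⟩
    (Y p - fromℕ 2) * 1/p + (1ℚ + T 0 p - T 1 p + T 2 p - T 3 p + 1ℚ) * 1/p ≡⟨ cong (λ z → (Y p - fromℕ 2) * 1/p + z * 1/p) alternating-p ⟩
    (Y p - fromℕ 2) * 1/p + 0ℚ * 1/p                                       ≡⟨ identity′ (Y p) 1/p ⟩
    (Y p - fromℕ 2) * 1/p                                                  ∎)
    (integral-+ (integral-+ ∫t₀ ∫t₂) (integral-neg (integral-* (integral-fromℤ (+ 2)) ∫t₁))))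
    where
    open ≡-Reasoning
    identity : ∀ i a b c d → i * a + i * c - fromℕ 2 * (i * b) ≡ (d - b - fromℕ 2) * i + (1ℚ + a - b + c - d + 1ℚ) * i
    identity = solve 5 (λ i a b c d → i :* a :+ i :* c :- con (fromℕ 2) :* (i :* b)
      := (d :- b :- con (fromℕ 2)) :* i :+ (con 1ℚ :+ a :- b :+ c :- d :+ con 1ℚ) :* i) refl
    identity′ : ∀ y i → (y - fromℕ 2) * i + 0ℚ * i ≡ (y - fromℕ 2) * i
    identity′ = solve 2 (λ y i → (y :- con (fromℕ 2)) :* i :+ con 0ℚ :* i := (y :- con (fromℕ 2)) :* i) refl

  t-integral⇒Y≈-2 : Integral (t 0) → Integral (t 2) → Integral (t 3) → Y p ≈ - fromℕ 2
  t-integral⇒Y≈-2 ∫t₀ ∫t₂ ∫t₃ = congruent (subst Integral (begin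
    fromℕ 2 * t 3 - t 0 - t 2                                               ≡⟨ identity 1/p (T 0 p) (T 1 p) (T 2 p) (T 3 p) ⟩
    (Y p - - fromℕ 2) * 1/p - (1ℚ + T 0 p - T 1 p + T 2 p - T 3 p + 1ℚ) * 1/p ≡⟨ cong (λ z → (Y p - - fromℕ 2) * 1/p - z * 1/p) alternating-p ⟩
    (Y p - - fromℕ 2) * 1/p - 0ℚ * 1/p                                       ≡⟨ identity′ (Y p) 1/p ⟩
    (Y p - - fromℕ 2) * 1/p                                                  ∎)
    (integral-+ (integral-+ (integral-* (integral-fromℤ (+ 2)) ∫t₃) (integral-neg ∫t₀)) (integral-neg ∫t₂)))
    where
    open ≡-Reasoning
    identity : ∀ i a b c d → fromℕ 2 * (i * d) - i * a - i * c ≡ (d - b - - fromℕ 2) * i - (1ℚ + a - b + c - d + 1ℚ) * i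
    identity = solve 5 (λ i a b c d → con (fromℕ 2) :* (i :* d) :- i :* a :- i :* c
      := (d :- b :- :- con (fromℕ 2)) :* i :- (con 1ℚ :+ a :- b :+ c :- d :+ con 1ℚ) :* i) refl
    identity′ : ∀ y i → (y - - fromℕ 2) * i - 0ℚ * i ≡ (y - - fromℕ 2) * i
    identity′ = solve 2 (λ y i → (y :- :- con (fromℕ 2)) :* i :- con 0ℚ :* i := (y :- :- con (fromℕ 2)) :* i) refl

  scale-t : ∀ s → fromℕ 4 * t s ≡ 1/p * (fromℕ 4 * T s p)
  scale-t s = identity (fromℕ 4) 1/p (T s p)
    where
    identity : ∀ f i x → f * (i * x) ≡ i * (f * x)
    identity = solve 3 (λ f i x → f :* (i :* x) := i :* (f :* x)) refl

  4t₀≡ : fromℕ 4 * t 0 ≡ fromℕ 3 * q p 3 + fromℕ 2 * a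
  4t₀≡ = begin
    fromℕ 4 * t 0                                                     ≡⟨ scale-t 0 ⟩
    1/p * (fromℕ 4 * T 0 p)                                           ≡⟨ cong (1/p *_) (4T₀ p) ⟩
    1/p * (fromℕ (3 ^ p) + sign p + fromℕ 2 * X p - fromℕ 4)           ≡⟨ cong₂ (λ e σ → 1/p * (e + σ + fromℕ 2 * X p - fromℕ 4)) (fromℕ[c^p] 3) sign-p ⟩
    1/p * (fromℕ 3 * E + - 1ℚ + fromℕ 2 * X p - fromℕ 4)               ≡⟨ identity 1/p E (X p) ⟩
    fromℕ 3 * ((E - 1ℚ) * 1/p) + fromℕ 2 * a                          ≡⟨ cong (λ z → fromℕ 3 * z + fromℕ 2 * a) (q≡ 3) ⟨
    fromℕ 3 * q p 3 + fromℕ 2 * a                                     ∎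
    where
    open ≡-Reasoning
    E = fromℕ (3 ^ (p ∸ 1))
    identity : ∀ i e x → i * (fromℕ 3 * e + - 1ℚ + fromℕ 2 * x - fromℕ 4) ≡ fromℕ 3 * ((e - 1ℚ) * i) + fromℕ 2 * ((x - 1ℚ) * i)
    identity = solve 3 (λ i e x → i :* (con (fromℕ 3) :* e :+ :- con 1ℚ :+ con (fromℕ 2) :* x :- con (fromℕ 4))
      := con (fromℕ 3) :* ((e :- con 1ℚ) :* i) :+ con (fromℕ 2) :* ((x :- con 1ℚ) :* i)) refl

  4t₁≡ : fromℕ 4 * t 1 ≡ fromℕ 3 * q p 3 - fromℕ 2 * b (fromℕ 2)
  4t₁≡ = begin
    fromℕ 4 * t 1                                                     ≡⟨ scale-t 1 ⟩
    1/p * (fromℕ 4 * T 1 p)                                           ≡⟨ cong (1/p *_) (4T₁ p) ⟩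
    1/p * (fromℕ (3 ^ p) - sign p - fromℕ 2 * Y p)                     ≡⟨ cong₂ (λ e σ → 1/p * (e - σ - fromℕ 2 * Y p)) (fromℕ[c^p] 3) sign-p ⟩
    1/p * (fromℕ 3 * E - - 1ℚ - fromℕ 2 * Y p)                         ≡⟨ identity 1/p E (Y p) ⟩
    fromℕ 3 * ((E - 1ℚ) * 1/p) - fromℕ 2 * b (fromℕ 2)                ≡⟨ cong (λ z → fromℕ 3 * z - fromℕ 2 * b (fromℕ 2)) (q≡ 3) ⟨
    fromℕ 3 * q p 3 - fromℕ 2 * b (fromℕ 2)                           ∎
    where
    open ≡-Reasoning
    E = fromℕ (3 ^ (p ∸ 1))
    identity : ∀ i e y → i * (fromℕ 3 * e - - 1ℚ - fromℕ 2 * y) ≡ fromℕ 3 * ((e - 1ℚ) * i) - fromℕ 2 * ((y - fromℕ 2) * i)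
    identity = solve 3 (λ i e y → i :* (con (fromℕ 3) :* e :- :- con 1ℚ :- con (fromℕ 2) :* y)
      := con (fromℕ 3) :* ((e :- con 1ℚ) :* i) :- con (fromℕ 2) :* ((y :- con (fromℕ 2)) :* i)) refl

  4t₃≡ : fromℕ 4 * t 3 ≡ fromℕ 3 * q p 3 + fromℕ 2 * b (- fromℕ 2)
  4t₃≡ = begin
    fromℕ 4 * t 3                                                     ≡⟨ scale-t 3 ⟩
    1/p * (fromℕ 4 * T 3 p)                                           ≡⟨ cong (1/p *_) (4T₃ p) ⟩
    1/p * (fromℕ (3 ^ p) - sign p + fromℕ 2 * Y p)                     ≡⟨ cong₂ (λ e σ → 1/p * (e - σ + fromℕ 2 * Y p)) (fromℕ[c^p] 3) sign-p ⟩
    1/p * (fromℕ 3 * E - - 1ℚ + fromℕ 2 * Y p)                         ≡⟨ identity 1/p E (Y p) ⟩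
    fromℕ 3 * ((E - 1ℚ) * 1/p) + fromℕ 2 * b (- fromℕ 2)              ≡⟨ cong (λ z → fromℕ 3 * z + fromℕ 2 * b (- fromℕ 2)) (q≡ 3) ⟨
    fromℕ 3 * q p 3 + fromℕ 2 * b (- fromℕ 2)                         ∎
    where
    open ≡-Reasoning
    E = fromℕ (3 ^ (p ∸ 1))
    identity : ∀ i e y → i * (fromℕ 3 * e - - 1ℚ + fromℕ 2 * y) ≡ fromℕ 3 * ((e - 1ℚ) * i) + fromℕ 2 * ((y - - fromℕ 2) * i)
    identity = solve 3 (λ i e y → i :* (con (fromℕ 3) :* e :- :- con 1ℚ :+ con (fromℕ 2) :* y)
      := con (fromℕ 3) :* ((e :- con 1ℚ) :* i) :+ con (fromℕ 2) :* ((y :- :- con (fromℕ 2)) :* i)) refl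

  Σ16^k/k≈ : ∀ {m} → m ℕ.≤ p → 4 ℕ.* m ℕ.< p ℕ.+ 0 → p ℕ.+ 0 ℕ.< 4 ℕ.* suc m →
        Σ1 m (λ k → frac (+ (16 ^ k)) k) ≈ - (fromℕ 3 * q p 3 + fromℕ 2 * a)
  Σ16^k/k≈ {m} m≤p below above = begin
    Σ1 m (λ k → frac (+ (16 ^ k)) k)                       ≡⟨ Sums.Σ1-cong m (λ {k} 0<k _ → frac-*ˡ (+ (16 ^ k)) 4 k {{_}} {{ℕ.>-nonZero 0<k}}) ⟩
    Σ1 m (λ k → fromℕ 4 * frac (+ (16 ^ k)) (4 ℕ.* k))      ≡⟨ Σ1-* m (fromℕ 4) _ ⟩
    fromℕ 4 * Σ1 m (λ k → frac (+ (16 ^ k)) (4 ℕ.* k))      ≈⟨ *-congˡ (integral-fromℤ (+ 4)) (Σ16^k≈ z≤n m≤p below above) ⟩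
    fromℕ 4 * (sign 1 * fromℕ (2 ^ 0) * t 0)               ≡⟨ identity (t 0) ⟩
    - (fromℕ 4 * t 0)                                      ≡⟨ cong -_ 4t₀≡ ⟩
    - (fromℕ 3 * q p 3 + fromℕ 2 * a)                      ∎
    where
    open ≈-Reasoning
    identity : ∀ x → fromℕ 4 * (sign 1 * fromℕ (2 ^ 0) * x) ≡ - (fromℕ 4 * x)
    identity = solve 1 (λ x → con (fromℕ 4) :* (con (sign 1 * fromℕ (2 ^ 0)) :* x) := :- (con (fromℕ 4) :* x)) refl

  5q₅≡ : ∀ c → c * c ≡ fromℕ 4 → fromℕ 5 * q p 5 ≡ a * (X p + 1ℚ) + b c * (Y p + c)
  5q₅≡ c c²≡4 = begin
    fromℕ 5 * q p 5                                         ≡⟨ cong (fromℕ 5 *_) (q≡ 5) ⟩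
    fromℕ 5 * ((E - 1ℚ) * 1/p)                              ≡⟨ identity 1/p E ⟩
    (fromℕ 5 * E - fromℕ 5) * 1/p                           ≡⟨ cong (λ z → (z - fromℕ 5) * 1/p) (trans (norm p) (fromℕ[c^p] 5)) ⟨
    (X p * X p + Y p * Y p - fromℕ 5) * 1/p                  ≡⟨ identity′ (X p) (Y p) c 1/p ⟩
    a * (X p + 1ℚ) + b c * (Y p + c) + (c * c - fromℕ 4) * 1/p ≡⟨ cong (λ z → a * (X p + 1ℚ) + b c * (Y p + c) + (z - fromℕ 4) * 1/p) c²≡4 ⟩
    a * (X p + 1ℚ) + b c * (Y p + c) + (fromℕ 4 - fromℕ 4) * 1/p ≡⟨ identity″ (a * (X p + 1ℚ) + b c * (Y p + c)) 1/p ⟩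
    a * (X p + 1ℚ) + b c * (Y p + c)                         ∎
    where
    open ≡-Reasoning
    E = fromℕ (5 ^ (p ∸ 1))
    identity : ∀ i e → fromℕ 5 * ((e - 1ℚ) * i) ≡ (fromℕ 5 * e - fromℕ 5) * i
    identity = solve 2 (λ i e → con (fromℕ 5) :* ((e :- con 1ℚ) :* i) := (con (fromℕ 5) :* e :- con (fromℕ 5)) :* i) refl
    identity′ : ∀ x y c i → (x * x + y * y - fromℕ 5) * i ≡
                (x - 1ℚ) * i * (x + 1ℚ) + (y - c) * i * (y + c) + (c * c - fromℕ 4) * i
    identity′ = solve 4 (λ x y c i → (x :* x :+ y :* y :- con (fromℕ 5)) :* i
      := (x :- con 1ℚ) :* i :* (x :+ con 1ℚ) :+ (y :- c) :* i :* (y :+ c) :+ (c :* c :- con (fromℕ 4)) :* i) refl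
    identity″ : ∀ z i → z + (fromℕ 4 - fromℕ 4) * i ≡ z
    identity″ = solve 2 (λ z i → z :+ (con (fromℕ 4) :- con (fromℕ 4)) :* i := z) refl

  q₅≈ : ∀ c → c * c ≡ fromℕ 4 → X p ≈ 1ℚ → Y p ≈ c → q p 5 ≈ frac (+ 1) 5 * (fromℕ 2 * a + fromℕ 2 * c * b c)
  q₅≈ c c²≡4 X≈1 Y≈c = begin
    q p 5                                                    ≡⟨ identity (q p 5) ⟩
    frac (+ 1) 5 * (fromℕ 5 * q p 5)                         ≡⟨ cong (frac (+ 1) 5 *_) (5q₅≡ c c²≡4) ⟩
    frac (+ 1) 5 * (a * (X p + 1ℚ) + b c * (Y p + c))         ≈⟨ *-congˡ (integral-frac (+ 1) 5 p∤5)
                                                                   (+-cong (*-congˡ ∫a (+-cong X≈1 ≈-refl)) (*-congˡ ∫b (+-cong Y≈c ≈-refl))) ⟩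
    frac (+ 1) 5 * (a * (1ℚ + 1ℚ) + b c * (c + c))            ≡⟨ cong (frac (+ 1) 5 *_) (identity′ a (b c) c) ⟩
    frac (+ 1) 5 * (fromℕ 2 * a + fromℕ 2 * c * b c)          ∎
    where
    open ≈-Reasoning
    ∫a = _≈_.integral-quotient X≈1
    ∫b = _≈_.integral-quotient Y≈c
    identity : ∀ x → x ≡ frac (+ 1) 5 * (fromℕ 5 * x)
    identity = solve 1 (λ x → x := con (frac (+ 1) 5) :* (con (fromℕ 5) :* x)) refl
    identity′ : ∀ a b c → a * (1ℚ + 1ℚ) + b * (c + c) ≡ fromℕ 2 * a + fromℕ 2 * c * b
    identity′ = solve 3 (λ a b c → a :* (con 1ℚ :+ con 1ℚ) :+ b :* (c :+ c) := con (fromℕ 2) :* a :+ con (fromℕ 2) :* c :* b) refl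

module Residues where

  open import Data.Nat.Base using (suc; _+_; _*_; _∸_; _<_; _%_; _/_)
  open import Data.Nat.Properties using (*-comm; *-suc; +-comm; m<m+n; +-monoʳ-<; m+n∸n≡m)
  open import Data.Nat.DivMod using (m≡m%n+[m/n]*n; m*n/n≡m)
  open import Data.Nat.Tactic.RingSolver using (solve-∀)
  open import Data.Product using (_×_; _,_)
  open import Relation.Binary.PropositionalEquality

  between-multiples : ∀ {n K e} → n ≡ 4 * K + e → 0 < e → e < 4 → 4 * K < n × n < 4 * suc K
  between-multiples {K = K} {e} refl 0<e e<4 =
    m<m+n (4 * K) 0<e , subst (4 * K + e <_) (trans (+-comm (4 * K) 4) (sym (*-suc 4 K))) (+-monoʳ-< (4 * K) e<4)

  residue-4 : ∀ {p r} → p % 4 ≡ r → p ≡ 4 * ((p ∸ r) / 4) + r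
  residue-4 {p} {r} p%4≡r = trans p≡4d+r (cong (λ m → 4 * m + r) (sym [p∸r]/4≡d))
    where
    d = p / 4
    p≡4d+r : p ≡ 4 * d + r
    p≡4d+r = trans (m≡m%n+[m/n]*n p 4) (trans (cong (_+ d * 4) p%4≡r) (trans (+-comm r (d * 4)) (cong (_+ r) (*-comm d 4))))
    [p∸r]/4≡d : (p ∸ r) / 4 ≡ d
    [p∸r]/4≡d = trans (cong (λ n → (n ∸ r) / 4) p≡4d+r) (trans (cong (_/ 4) (trans (m+n∸n≡m (4 * d) r) (*-comm 4 d))) (m*n/n≡m d 4))

  [4m+3+1]/4≡1+m : ∀ m → (4 * m + 3 + 1) / 4 ≡ suc m
  [4m+3+1]/4≡1+m m = trans (cong (_/ 4) (regroup m)) (m*n/n≡m (suc m) 4)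
    where
    regroup : ∀ m → 4 * m + 3 + 1 ≡ suc m * 4
    regroup = solve-∀

module Case₁ (p : ℕ) (p-prime : Prime p) (5<p : 5 ℕ.< p) (p%4≡1 : p ℕ.% 4 ≡ 1) where

  open import Data.Integer.Base using (+_)
  open import Data.Nat.Base as ℕ using (suc; _∸_; _/_; _^_; z≤n; s≤s)
  import Data.Nat.Properties as ℕ
  open import Data.Nat.Tactic.RingSolver using (solve-∀)
  open import Data.Product using (_×_; _,_)
  open import Data.Rational.Base using (ℚ; 1ℚ; _+_; _*_; -_; _-_)
  open import Data.Rational.Solver using (module +-*-Solver)
  open import Relation.Binary.PropositionalEquality
  open +-*-Solver using (solve; _:+_; _:*_; _:-_; :-_; _:=_; con)
  open Embedding
  open Reciprocals
  open Signs
  open Congruence p p-prime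
  open Quadrisection
  open QuadrisectionModP p p-prime
  open Residues

  m : ℕ
  m = (p ∸ 1) / 4

  p≡4m+1 : p ≡ 4 ℕ.* m ℕ.+ 1
  p≡4m+1 = residue-4 p%4≡1

  p≡1+2[2m] : p ≡ suc (2 ℕ.* m ℕ.+ 2 ℕ.* m)
  p≡1+2[2m] = trans p≡4m+1 (regroup m)
    where
    regroup : ∀ m → 4 ℕ.* m ℕ.+ 1 ≡ suc (2 ℕ.* m ℕ.+ 2 ℕ.* m)
    regroup = solve-∀

  open OddPrime p p-prime 5<p (2 ℕ.* m) p≡1+2[2m]

  m≤p : m ℕ.≤ p
  m≤p = subst (m ℕ.≤_) (sym p≡4m+1) (ℕ.≤-trans (ℕ.m≤n*m m 4) (ℕ.m≤m+n (4 ℕ.* m) 1))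

  bounds : ∀ {s} → s ℕ.≤ 2 → 4 ℕ.* m ℕ.< p ℕ.+ s × p ℕ.+ s ℕ.< 4 ℕ.* suc m
  bounds {s} s≤2 = between-multiples (trans (cong (ℕ._+ s) p≡4m+1) (ℕ.+-assoc (4 ℕ.* m) 1 s)) (s≤s z≤n) (s≤s (s≤s s≤2))

  integral-t : ∀ {s} → s ℕ.≤ 2 → Integral (t s)
  integral-t s≤2 with bounds s≤2
  ... | below , above = T/p-integral (ℕ.m≤n⇒m≤1+n s≤2) m≤p below above

  X≈1 : X p ≈ 1ℚ
  X≈1 = t-integral⇒X≈1 (integral-t z≤n) (integral-t (s≤s (s≤s z≤n)))

  Y≈2 : Y p ≈ fromℕ 2
  Y≈2 = t-integral⇒Y≈2 (integral-t z≤n) (integral-t (s≤s z≤n)) (integral-t (s≤s (s≤s z≤n)))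

  Sa Sb : ℚ
  Sa = Σ1 m (λ k → frac (+ (16 ^ k)) k)
  Sb = Σ1 m (λ k → frac (+ (16 ^ k)) (4 ℕ.* k ∸ 1))

  Sa≈ : Sa ≈ - (fromℕ 3 * q p 3 + fromℕ 2 * a)
  Sa≈ with bounds z≤n
  ... | below , above = Σ16^k/k≈ m≤p below above

  Sb≈ : Sb ≈ frac (+ 1) 2 * (fromℕ 3 * q p 3 - fromℕ 2 * b (fromℕ 2))
  Sb≈ with bounds (s≤s z≤n)
  ... | below , above = begin
    Sb                                                 ≈⟨ Σ16^k≈ (s≤s z≤n) m≤p below above ⟩
    sign 2 * fromℕ (2 ^ 1) * t 1                        ≡⟨ identity (t 1) ⟩
    frac (+ 1) 2 * (fromℕ 4 * t 1)                      ≡⟨ cong (frac (+ 1) 2 *_) 4t₁≡ ⟩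
    frac (+ 1) 2 * (fromℕ 3 * q p 3 - fromℕ 2 * b (fromℕ 2)) ∎
    where
    open ≈-Reasoning
    identity : ∀ x → sign 2 * fromℕ (2 ^ 1) * x ≡ frac (+ 1) 2 * (fromℕ 4 * x)
    identity = solve 1 (λ x → con (sign 2 * fromℕ (2 ^ 1)) :* x := con (frac (+ 1) 2) :* (con (fromℕ 4) :* x)) refl

  common : ℚ
  common = frac (+ 1) 10 * (b (fromℕ 2) - fromℕ 2 * a)

  u/p≡common : frac (u (p ∸ 1)) p ≡ common
  u/p≡common = begin
    frac (u (p ∸ 1)) p                                     ≡⟨ frac≡fromℤ*frac1 (u (p ∸ 1)) p ⟩
    fromℤ (u (p ∸ 1)) * 1/p                                ≡⟨ identity (fromℤ (u (p ∸ 1))) 1/p ⟩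
    frac (+ 1) 10 * (fromℕ 10 * fromℤ (u (p ∸ 1))) * 1/p    ≡⟨ cong (λ z → frac (+ 1) 10 * z * 1/p) 10u[p-1]≡Yₚ-2Xₚ ⟩
    frac (+ 1) 10 * (Y p - fromℕ 2 * X p) * 1/p             ≡⟨ identity′ (Y p) (X p) 1/p ⟩
    common                                                      ∎
    where
    open ≡-Reasoning
    10u[p-1]≡Yₚ-2Xₚ : fromℕ 10 * fromℤ (u (p ∸ 1)) ≡ Y p - fromℕ 2 * X p
    10u[p-1]≡Yₚ-2Xₚ = trans (10u≡Y-2X (p ∸ 1)) (cong (λ n → Y n - fromℕ 2 * X n) (ℕ.suc-pred p))
    identity : ∀ x i → x * i ≡ frac (+ 1) 10 * (fromℕ 10 * x) * i
    identity = solve 2 (λ x i → x :* i := con (frac (+ 1) 10) :* (con (fromℕ 10) :* x) :* i) refl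
    identity′ : ∀ y x i → frac (+ 1) 10 * (y - fromℕ 2 * x) * i ≡ frac (+ 1) 10 * ((y - fromℕ 2) * i - fromℕ 2 * ((x - 1ℚ) * i))
    identity′ = solve 3 (λ y x i → con (frac (+ 1) 10) :* (y :- con (fromℕ 2) :* x) :* i
      := con (frac (+ 1) 10) :* ((y :- con (fromℕ 2)) :* i :- con (fromℕ 2) :* ((x :- con 1ℚ) :* i))) refl

  rhs₁ rhs₂ : ℚ
  rhs₁ = frac (+ 1) 8 * Sa + frac (+ 3) 8 * q p 3 + frac (+ 1) 8 * q p 5
  rhs₂ = - (frac (+ 1) 2 * Sb) + frac (+ 3) 4 * q p 3 - frac (+ 1) 2 * q p 5

  rhs₁≈common : rhs₁ ≈ common
  rhs₁≈common = begin
    rhs₁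
      ≈⟨ +-cong (+-cong (*-congˡ (integral-/8 (+ 1)) Sa≈) ≈-refl) (*-congˡ (integral-/8 (+ 1)) (q₅≈ (fromℕ 2) refl X≈1 Y≈2)) ⟩
    frac (+ 1) 8 * - (fromℕ 3 * q p 3 + fromℕ 2 * a) + frac (+ 3) 8 * q p 3
      + frac (+ 1) 8 * (frac (+ 1) 5 * (fromℕ 2 * a + fromℕ 2 * fromℕ 2 * b (fromℕ 2)))
      ≡⟨ identity (q p 3) a (b (fromℕ 2)) ⟩
    common ∎
    where
    open ≈-Reasoning
    identity : ∀ q₃ a b → frac (+ 1) 8 * - (fromℕ 3 * q₃ + fromℕ 2 * a) + frac (+ 3) 8 * q₃
                          + frac (+ 1) 8 * (frac (+ 1) 5 * (fromℕ 2 * a + fromℕ 2 * fromℕ 2 * b))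
                          ≡ frac (+ 1) 10 * (b - fromℕ 2 * a)
    identity = solve 3 (λ q₃ a b → con (frac (+ 1) 8) :* :- (con (fromℕ 3) :* q₃ :+ con (fromℕ 2) :* a) :+ con (frac (+ 3) 8) :* q₃
      :+ con (frac (+ 1) 8) :* (con (frac (+ 1) 5) :* (con (fromℕ 2) :* a :+ con (fromℕ 2) :* con (fromℕ 2) :* b))
      := con (frac (+ 1) 10) :* (b :- con (fromℕ 2) :* a)) refl

  rhs₂≈common : rhs₂ ≈ common
  rhs₂≈common = begin
    rhs₂
      ≈⟨ -‿cong (+-cong (neg-cong (*-congˡ (integral-/2 (+ 1)) Sb≈)) ≈-refl) (*-congˡ (integral-/2 (+ 1)) (q₅≈ (fromℕ 2) refl X≈1 Y≈2)) ⟩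
    - (frac (+ 1) 2 * (frac (+ 1) 2 * (fromℕ 3 * q p 3 - fromℕ 2 * b (fromℕ 2)))) + frac (+ 3) 4 * q p 3
      - frac (+ 1) 2 * (frac (+ 1) 5 * (fromℕ 2 * a + fromℕ 2 * fromℕ 2 * b (fromℕ 2)))
      ≡⟨ identity (q p 3) a (b (fromℕ 2)) ⟩
    common ∎
    where
    open ≈-Reasoning
    identity : ∀ q₃ a b → - (frac (+ 1) 2 * (frac (+ 1) 2 * (fromℕ 3 * q₃ - fromℕ 2 * b))) + frac (+ 3) 4 * q₃
                          - frac (+ 1) 2 * (frac (+ 1) 5 * (fromℕ 2 * a + fromℕ 2 * fromℕ 2 * b))
                          ≡ frac (+ 1) 10 * (b - fromℕ 2 * a)
    identity = solve 3 (λ q₃ a b → :- (con (frac (+ 1) 2) :* (con (frac (+ 1) 2) :* (con (fromℕ 3) :* q₃ :- con (fromℕ 2) :* b)))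
      :+ con (frac (+ 3) 4) :* q₃
      :- con (frac (+ 1) 2) :* (con (frac (+ 1) 5) :* (con (fromℕ 2) :* a :+ con (fromℕ 2) :* con (fromℕ 2) :* b))
      := con (frac (+ 1) 10) :* (b :- con (fromℕ 2) :* a)) refl

  congruences : frac (u (p ∸ 1)) p ≡ rhs₁ [modℚ p ] × rhs₁ ≡ rhs₂ [modℚ p ]
  congruences = ≈-sound (≈-trans (≈-reflexive u/p≡common) (≈-sym rhs₁≈common)) , ≈-sound (≈-trans rhs₁≈common (≈-sym rhs₂≈common))

module Case₃ (p : ℕ) (p-prime : Prime p) (5<p : 5 ℕ.< p) (p%4≡3 : p ℕ.% 4 ≡ 3) where

  open import Data.Integer.Base using (+_)
  open import Data.Nat.Base as ℕ using (suc; _∸_; _/_; _^_; z≤n; s≤s)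
  import Data.Nat.Properties as ℕ
  open import Data.Nat.Tactic.RingSolver using (solve-∀)
  open import Data.Product using (_×_; _,_)
  open import Data.Rational.Base using (ℚ; 1ℚ; _+_; _*_; -_; _-_)
  open import Data.Rational.Solver using (module +-*-Solver)
  open import Relation.Binary.PropositionalEquality
  open +-*-Solver using (solve; _:+_; _:*_; _:-_; :-_; _:=_; con)
  open Embedding
  open Reciprocals
  open Signs
  open Congruence p p-prime
  open Quadrisection
  open QuadrisectionModP p p-prime
  open Residues

  m : ℕ
  m = (p ∸ 3) / 4

  p≡4m+3 : p ≡ 4 ℕ.* m ℕ.+ 3
  p≡4m+3 = residue-4 p%4≡3

  p≡1+2[2m+1] : p ≡ suc ((2 ℕ.* m ℕ.+ 1) ℕ.+ (2 ℕ.* m ℕ.+ 1))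
  p≡1+2[2m+1] = trans p≡4m+3 (regroup m)
    where
    regroup : ∀ m → 4 ℕ.* m ℕ.+ 3 ≡ suc ((2 ℕ.* m ℕ.+ 1) ℕ.+ (2 ℕ.* m ℕ.+ 1))
    regroup = solve-∀

  open OddPrime p p-prime 5<p (2 ℕ.* m ℕ.+ 1) p≡1+2[2m+1]

  m≤p : m ℕ.≤ p
  m≤p = subst (m ℕ.≤_) (sym p≡4m+3) (ℕ.≤-trans (ℕ.m≤n*m m 4) (ℕ.m≤m+n (4 ℕ.* m) 3))

  1+m≤p : suc m ℕ.≤ p
  1+m≤p = subst (suc m ℕ.≤_) (sym p≡4m+3) (subst (ℕ._≤ 4 ℕ.* m ℕ.+ 3) (ℕ.+-comm m 1) (ℕ.+-mono-≤ (ℕ.m≤n*m m 4) (s≤s z≤n)))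

  bounds₀ : 4 ℕ.* m ℕ.< p ℕ.+ 0 × p ℕ.+ 0 ℕ.< 4 ℕ.* suc m
  bounds₀ = between-multiples (trans (ℕ.+-identityʳ p) p≡4m+3) (s≤s z≤n) (s≤s (s≤s (s≤s (s≤s z≤n))))

  bounds₂ : 4 ℕ.* suc m ℕ.< p ℕ.+ 2 × p ℕ.+ 2 ℕ.< 4 ℕ.* suc (suc m)
  bounds₂ = between-multiples {K = suc m} (trans (cong (ℕ._+ 2) p≡4m+3) (regroup m)) (s≤s z≤n) (s≤s (s≤s z≤n))
    where
    regroup : ∀ m → 4 ℕ.* m ℕ.+ 3 ℕ.+ 2 ≡ 4 ℕ.* suc m ℕ.+ 1
    regroup = solve-∀

  bounds₃ : 4 ℕ.* suc m ℕ.< p ℕ.+ 3 × p ℕ.+ 3 ℕ.< 4 ℕ.* suc (suc m)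
  bounds₃ = between-multiples {K = suc m} (trans (cong (ℕ._+ 3) p≡4m+3) (regroup m)) (s≤s z≤n) (s≤s (s≤s (s≤s z≤n)))
    where
    regroup : ∀ m → 4 ℕ.* m ℕ.+ 3 ℕ.+ 3 ≡ 4 ℕ.* suc m ℕ.+ 2
    regroup = solve-∀

  integral-t₀ : Integral (t 0)
  integral-t₀ with bounds₀
  ... | below , above = T/p-integral z≤n m≤p below above

  integral-t₂ : Integral (t 2)
  integral-t₂ with bounds₂
  ... | below , above = T/p-integral (s≤s (s≤s z≤n)) 1+m≤p below above

  integral-t₃ : Integral (t 3)
  integral-t₃ with bounds₃
  ... | below , above = T/p-integral ℕ.≤-refl 1+m≤p below above

  X≈1 : X p ≈ 1ℚ
  X≈1 = t-integral⇒X≈1 integral-t₀ integral-t₂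

  Y≈-2 : Y p ≈ - fromℕ 2
  Y≈-2 = t-integral⇒Y≈-2 integral-t₀ integral-t₂ integral-t₃

  Sa Sb : ℚ
  Sa = Σ1 m (λ k → frac (+ (16 ^ k)) k)
  Sb = Σ1 ((p ℕ.+ 1) / 4) (λ k → frac (+ (16 ^ k)) (4 ℕ.* k ∸ 3))

  Sa≈ : Sa ≈ - (fromℕ 3 * q p 3 + fromℕ 2 * a)
  Sa≈ with bounds₀
  ... | below , above = Σ16^k/k≈ m≤p below above

  Sb≈ : Sb ≈ fromℕ 2 * (fromℕ 3 * q p 3 + fromℕ 2 * b (- fromℕ 2))
  Sb≈ with bounds₃
  ... | below , above = begin
    Sb                                                  ≡⟨ cong (λ K → Σ1 K (λ k → frac (+ (16 ^ k)) (4 ℕ.* k ∸ 3))) [p+1]/4≡1+m ⟩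
    Σ1 (suc m) (λ k → frac (+ (16 ^ k)) (4 ℕ.* k ∸ 3))   ≈⟨ Σ16^k≈ ℕ.≤-refl 1+m≤p below above ⟩
    sign 4 * fromℕ (2 ^ 3) * t 3                         ≡⟨ identity (t 3) ⟩
    fromℕ 2 * (fromℕ 4 * t 3)                            ≡⟨ cong (fromℕ 2 *_) 4t₃≡ ⟩
    fromℕ 2 * (fromℕ 3 * q p 3 + fromℕ 2 * b (- fromℕ 2)) ∎
    where
    open ≈-Reasoning
    [p+1]/4≡1+m : (p ℕ.+ 1) / 4 ≡ suc m
    [p+1]/4≡1+m = trans (cong (λ n → (n ℕ.+ 1) / 4) p≡4m+3) ([4m+3+1]/4≡1+m m)
    identity : ∀ x → sign 4 * fromℕ (2 ^ 3) * x ≡ fromℕ 2 * (fromℕ 4 * x)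
    identity = solve 1 (λ x → con (sign 4 * fromℕ (2 ^ 3)) :* x := con (fromℕ 2) :* (con (fromℕ 4) :* x)) refl

  common : ℚ
  common = frac (+ 1) 2 * (b (- fromℕ 2) + fromℕ 2 * a)

  u/p≡common : frac (u (p ℕ.+ 1)) p ≡ common
  u/p≡common = begin
    frac (u (p ℕ.+ 1)) p                                  ≡⟨ frac≡fromℤ*frac1 (u (p ℕ.+ 1)) p ⟩
    fromℤ (u (p ℕ.+ 1)) * 1/p                             ≡⟨ identity (fromℤ (u (p ℕ.+ 1))) 1/p ⟩
    frac (+ 1) 2 * (fromℕ 2 * fromℤ (u (p ℕ.+ 1))) * 1/p   ≡⟨ cong (λ z → frac (+ 1) 2 * z * 1/p) 2u[p+1]≡Yₚ+2Xₚ ⟩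
    frac (+ 1) 2 * (Y p + fromℕ 2 * X p) * 1/p             ≡⟨ identity′ (Y p) (X p) 1/p ⟩
    common                                                     ∎
    where
    open ≡-Reasoning
    2u[p+1]≡Yₚ+2Xₚ : fromℕ 2 * fromℤ (u (p ℕ.+ 1)) ≡ Y p + fromℕ 2 * X p
    2u[p+1]≡Yₚ+2Xₚ = trans (sym (Y≡2u (p ℕ.+ 1))) (trans (cong Y (ℕ.+-comm p 1)) (Y-suc p))
    identity : ∀ x i → x * i ≡ frac (+ 1) 2 * (fromℕ 2 * x) * i
    identity = solve 2 (λ x i → x :* i := con (frac (+ 1) 2) :* (con (fromℕ 2) :* x) :* i) refl
    identity′ : ∀ y x i → frac (+ 1) 2 * (y + fromℕ 2 * x) * i ≡ frac (+ 1) 2 * ((y - - fromℕ 2) * i + fromℕ 2 * ((x - 1ℚ) * i))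
    identity′ = solve 3 (λ y x i → con (frac (+ 1) 2) :* (y :+ con (fromℕ 2) :* x) :* i
      := con (frac (+ 1) 2) :* ((y :- :- con (fromℕ 2)) :* i :+ con (fromℕ 2) :* ((x :- con 1ℚ) :* i))) refl

  rhs₁ rhs₂ : ℚ
  rhs₁ = - (frac (+ 5) 8 * Sa) - frac (+ 15) 8 * q p 3 - frac (+ 5) 8 * q p 5
  rhs₂ = frac (+ 5) 8 * Sb - frac (+ 15) 4 * q p 3 + frac (+ 5) 2 * q p 5

  rhs₁≈common : rhs₁ ≈ common
  rhs₁≈common = begin
    rhs₁
      ≈⟨ -‿cong (-‿cong (neg-cong (*-congˡ (integral-/8 (+ 5)) Sa≈)) ≈-refl)
                (*-congˡ (integral-/8 (+ 5)) (q₅≈ (- fromℕ 2) refl X≈1 Y≈-2)) ⟩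
    - (frac (+ 5) 8 * - (fromℕ 3 * q p 3 + fromℕ 2 * a)) - frac (+ 15) 8 * q p 3
      - frac (+ 5) 8 * (frac (+ 1) 5 * (fromℕ 2 * a + fromℕ 2 * - fromℕ 2 * b (- fromℕ 2)))
      ≡⟨ identity (q p 3) a (b (- fromℕ 2)) ⟩
    common ∎
    where
    open ≈-Reasoning
    identity : ∀ q₃ a b → - (frac (+ 5) 8 * - (fromℕ 3 * q₃ + fromℕ 2 * a)) - frac (+ 15) 8 * q₃
                          - frac (+ 5) 8 * (frac (+ 1) 5 * (fromℕ 2 * a + fromℕ 2 * - fromℕ 2 * b))
                          ≡ frac (+ 1) 2 * (b + fromℕ 2 * a)
    identity = solve 3 (λ q₃ a b → :- (con (frac (+ 5) 8) :* :- (con (fromℕ 3) :* q₃ :+ con (fromℕ 2) :* a))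
      :- con (frac (+ 15) 8) :* q₃
      :- con (frac (+ 5) 8) :* (con (frac (+ 1) 5) :* (con (fromℕ 2) :* a :+ con (fromℕ 2) :* :- con (fromℕ 2) :* b))
      := con (frac (+ 1) 2) :* (b :+ con (fromℕ 2) :* a)) refl

  rhs₂≈common : rhs₂ ≈ common
  rhs₂≈common = begin
    rhs₂
      ≈⟨ +-cong (-‿cong (*-congˡ (integral-/8 (+ 5)) Sb≈) ≈-refl)
                (*-congˡ (integral-/2 (+ 5)) (q₅≈ (- fromℕ 2) refl X≈1 Y≈-2)) ⟩
    frac (+ 5) 8 * (fromℕ 2 * (fromℕ 3 * q p 3 + fromℕ 2 * b (- fromℕ 2))) - frac (+ 15) 4 * q p 3
      + frac (+ 5) 2 * (frac (+ 1) 5 * (fromℕ 2 * a + fromℕ 2 * - fromℕ 2 * b (- fromℕ 2)))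
      ≡⟨ identity (q p 3) a (b (- fromℕ 2)) ⟩
    common ∎
    where
    open ≈-Reasoning
    identity : ∀ q₃ a b → frac (+ 5) 8 * (fromℕ 2 * (fromℕ 3 * q₃ + fromℕ 2 * b)) - frac (+ 15) 4 * q₃
                          + frac (+ 5) 2 * (frac (+ 1) 5 * (fromℕ 2 * a + fromℕ 2 * - fromℕ 2 * b))
                          ≡ frac (+ 1) 2 * (b + fromℕ 2 * a)
    identity = solve 3 (λ q₃ a b → con (frac (+ 5) 8) :* (con (fromℕ 2) :* (con (fromℕ 3) :* q₃ :+ con (fromℕ 2) :* b))
      :- con (frac (+ 15) 4) :* q₃
      :+ con (frac (+ 5) 2) :* (con (frac (+ 1) 5) :* (con (fromℕ 2) :* a :+ con (fromℕ 2) :* :- con (fromℕ 2) :* b))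
      := con (frac (+ 1) 2) :* (b :+ con (fromℕ 2) :* a)) refl

  congruences : frac (u (p ℕ.+ 1)) p ≡ rhs₁ [modℚ p ] × rhs₁ ≡ rhs₂ [modℚ p ]
  congruences = ≈-sound (≈-trans (≈-reflexive u/p≡common) (≈-sym rhs₁≈common)) , ≈-sound (≈-trans rhs₁≈common (≈-sym rhs₂≈common))

open import Data.Nat as ℕ using (_<_; _%_; _/_; _∸_; _+_; _*_; _^_)
open import Data.Integer as ℤ using (+_)
open import Data.Rational as ℚ using (ℚ)
open import Data.Product using (_×_; _,_)

corollary5p5 : (p : ℕ) → Prime p → 5 < p →
    ((p % 4 ≡ 1) →
      (frac (u (p ∸ 1)) p
         ≡ (frac (+ 1) 8 ℚ.* Σ1 ((p ∸ 1) / 4) (λ k → frac (+ (16 ^ k)) k)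
            ℚ.+ frac (+ 3) 8 ℚ.* q p 3 ℚ.+ frac (+ 1) 8 ℚ.* q p 5) [modℚ p ])
      × ((frac (+ 1) 8 ℚ.* Σ1 ((p ∸ 1) / 4) (λ k → frac (+ (16 ^ k)) k)
            ℚ.+ frac (+ 3) 8 ℚ.* q p 3 ℚ.+ frac (+ 1) 8 ℚ.* q p 5)
         ≡ (ℚ.- (frac (+ 1) 2 ℚ.* Σ1 ((p ∸ 1) / 4) (λ k → frac (+ (16 ^ k)) (4 * k ∸ 1)))
            ℚ.+ frac (+ 3) 4 ℚ.* q p 3 ℚ.- frac (+ 1) 2 ℚ.* q p 5) [modℚ p ]))
    × ((p % 4 ≡ 3) →
      (frac (u (p + 1)) p
         ≡ (ℚ.- (frac (+ 5) 8 ℚ.* Σ1 ((p ∸ 3) / 4) (λ k → frac (+ (16 ^ k)) k))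
            ℚ.- frac (+ 15) 8 ℚ.* q p 3 ℚ.- frac (+ 5) 8 ℚ.* q p 5) [modℚ p ])
      × ((ℚ.- (frac (+ 5) 8 ℚ.* Σ1 ((p ∸ 3) / 4) (λ k → frac (+ (16 ^ k)) k))
            ℚ.- frac (+ 15) 8 ℚ.* q p 3 ℚ.- frac (+ 5) 8 ℚ.* q p 5)
         ≡ (frac (+ 5) 8 ℚ.* Σ1 ((p + 1) / 4) (λ k → frac (+ (16 ^ k)) (4 * k ∸ 3))
            ℚ.- frac (+ 15) 4 ℚ.* q p 3 ℚ.+ frac (+ 5) 2 ℚ.* q p 5) [modℚ p ]))
corollary5p5 p p-prime 5<p = Case₁.congruences p p-prime 5<p , Case₃.congruences p p-prime 5<p
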